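{- Let $c$ be a real or complex number, $\underline{c}=(c,c,c,\dots)$, and $k\ge 0$ an integer. Then for every integer $n\ge 0$, $$D_{0,k,(k+1)n}(\underline{c})=(-1)^{\binom{k+1}{2}n},$$ and $D_{0,k,n}(\underline{c})=0$ for every integer $n\ge0$ that is not a multiple of $k+1$.
   Context: For a sequence $\mathbf{s}=(s_k)_{k\ge0}$ define numbers $a_{n,k}(\mathbf{s})$ for $n\ge 0$, $k\in\mathbb{Z}$ by $a_{0,k}(\mathbf{s})=[k=0]$ (i.e. $1$ if $k=0$, else $0$), $a_{n,k}(\mathbf{s})=0$ for $k<0$, and for $n\ge1$, $k\ge 0$: $a_{n,k}(\mathbf{s})=a_{n-1,k-1}(\mathbf{s})+s_k\,a_{n-1,k}(\mathbf{s})+a_{n-1,k+1}(\mathbf{s})$. For $k\ge0$ and $n\ge 0$ define $D_{0,k,n}(\mathbf{s})=\det\left(a_{i+j,k}(\mathbf{s})\right)_{i,j=0}^{n-1}$, with $D_{0,k,0}(\mathbf{s})=1$. -}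

module Defs where

open import Level using (Level)
open import Data.Nat using (ℕ; zero; suc) renaming (_+_ to _+ℕ_)
open import Data.Fin using (Fin; zero; suc; toℕ; punchIn)
open import Algebra.Bundles using (CommutativeRing)

module _ {c ℓ : Level} (R : CommutativeRing c ℓ) where
  open CommutativeRing R using (Carrier; _+_; _*_; -_; 0#; 1#)

  sgn : ℕ → Carrier
  sgn zero = 1#
  sgn (suc m) = - sgn m

  sumFin : (n : ℕ) → (Fin n → Carrier) → Carrier
  sumFin zero f = 0#
  sumFin (suc n) f = f zero + sumFin n (λ i → f (suc i))

  det : (n : ℕ) → (Fin n → Fin n → Carrier) → Carrier
  det zero M = 1#
  det (suc n) M =
    sumFin (suc n) (λ j → sgn (toℕ j) * (M zero j * det n (λ r q → M (suc r) (punchIn j q))))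

  -- a_{n,k}(s); entries with negative k are 0, so the k = 0 row omits a_{n-1,-1}
  a : (ℕ → Carrier) → ℕ → ℕ → Carrier
  a s zero zero = 1#
  a s zero (suc k) = 0#
  a s (suc n) zero = s zero * a s n zero + a s n (suc zero)
  a s (suc n) (suc k) = a s n k + s (suc k) * a s n (suc k) + a s n (suc (suc k))

  D0 : (ℕ → Carrier) → ℕ → ℕ → Carrier
  D0 s k n = det n (λ i j → a s (toℕ i +ℕ toℕ j) k)

{-# OPTIONS --safe #-}
-- For constant s the rows of A = (a_{n,l}) satisfy A_{n+1} = J A_n for the tridiagonal operator
-- (J u)_l = u_{l-1} + x u_l + u_{l+1}, so A is lower unitriangular.  The symmetric 0/1 matrix
-- T_{lm} = [|l - m| ≤ k ≤ l + m, l + m + k even] commutes with J and has row 0 equal to e_k, so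
-- moving J across the form (u, v) ↦ uᵀ T v gives a_{i+j,k} = (A T Aᵀ)_{ij}, whence D_{0,k,n} = det T_n
-- for the leading n × n block T_n.  Subtracting column 2k - j from column j for k < j ≤ 2k makes
-- T_{(k+1)+n} block upper triangular, with diagonal blocks T_n and an anti-triangular (k+1) × (k+1)
-- block of determinant (-1)^C(k+1,2); and for 0 < n ≤ k the first row of T_n vanishes.
module Submission where

open import Level using (Level; _⊔_)
open import Function using (id; _∘_; _⇔_; mk⇔; Equivalence)
open import Data.Nat using (ℕ; zero; suc; _≤_; _<_; z≤n; s≤s; _≟_; _≤?_; _<?_)
import Data.Nat as ℕ
import Data.Nat.Properties as ℕₚ
open import Data.Nat.Combinatorics using (_C_; nC1≡n; nCk+nC[k+1]≡[n+1]C[k+1])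
open import Data.Nat.DivMod using (_/_; _%_; m≡m%n+[m/n]*n; m%n<n)
open import Data.Nat.Divisibility using (_∣_; m%n≡0⇒n∣m)
open import Data.Nat.Tactic.RingSolver using (solve-∀)
open import Data.Fin using (Fin; toℕ) renaming (zero to fzero; suc to fsuc)
import Data.Fin as Fin
open import Data.Product using (_×_; _,_; proj₁; proj₂; ∃)
open import Data.Sum using (_⊎_; inj₁; inj₂)
open import Data.Empty using (⊥-elim)
open import Relation.Nullary using (¬_; Dec; yes; no; contradiction)
open import Relation.Nullary.Decidable using (_×-dec_)
open import Relation.Binary.PropositionalEquality as ≡ using (_≡_; _≢_)
open import Relation.Binary.Definitions using (tri<; tri≈; tri>)
open import Algebra.Bundles using (CommutativeRing)
open import Defs using (D0; sgn; a)
import Defs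

module _ where
  open import Data.Nat using (_+_; parity)
  open import Data.Nat.Properties
  open import Data.Parity.Base using (0ℙ)
  import Data.Parity.Properties as ℙ
  open ≡ using (refl; sym; trans; cong; subst)

  Even : ℕ → Set
  Even n = parity n ≡ 0ℙ

  parity-double+ : ∀ c b → parity (c + c + b) ≡ parity b
  parity-double+ zero    b = refl
  parity-double+ (suc c) b = trans (cong (λ n → parity (suc n + b)) (+-suc c c)) (parity-double+ c b)

  Even-transfer : ∀ c d {a b} → c + c + a ≡ d + d + b → Even b → Even a
  Even-transfer c d {a} {b} eq even-b = begin
    parity a            ≡⟨ sym (parity-double+ c a) ⟩
    parity (c + c + a)  ≡⟨ cong parity eq ⟩
    parity (d + d + b)  ≡⟨ parity-double+ d b ⟩
    parity b            ≡⟨ even-b ⟩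
    0ℙ                  ∎
    where open ≡.≡-Reasoning

  Even-double : ∀ c → Even (c + c)
  Even-double c = Even-transfer 0 c (sym (+-identityʳ (c + c))) refl

  ¬Even-odd : ∀ c → ¬ Even (suc (c + c))
  ¬Even-odd c even = contradiction (Even-transfer c 0 (+-comm (c + c) 1) even) λ ()

  -- U_l U_m = ∑ { U_k ∣ Triangle k l m } for the Chebyshev polynomials U of the second kind.
  Triangle : ℕ → ℕ → ℕ → Set
  Triangle k l m = k ≤ l + m × l ≤ k + m × m ≤ k + l × Even (l + m + k)

  triangle? : ∀ k l m → Dec (Triangle k l m)
  triangle? k l m =
    k ≤? l + m ×-dec l ≤? k + m ×-dec m ≤? k + l ×-dec parity (l + m + k) ℙ.≟ 0ℙ

  module _ {k : ℕ} where
    open ≤-Reasoning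

    Triangle-sym : ∀ {l m} → Triangle k l m → Triangle k m l
    Triangle-sym {l} {m} (k≤l+m , l≤k+m , m≤k+l , even) =
      subst (k ≤_) (+-comm l m) k≤l+m , m≤k+l , l≤k+m ,
      subst Even (cong (_+ k) (+-comm l m)) even

    Triangle-zeroˡ : ∀ {m} → Triangle k 0 m → m ≡ k
    Triangle-zeroˡ {m} (k≤m , _ , m≤k+0 , _) = ≤-antisym (subst (m ≤_) (+-identityʳ k) m≤k+0) k≤m

    <⇒¬Triangle : ∀ {l m} → l + m < k → ¬ Triangle k l m
    <⇒¬Triangle l+m<k (k≤l+m , _) = <⇒≱ l+m<k k≤l+m

    >⇒¬Triangle : ∀ {l m} → k + l < m → ¬ Triangle k l m
    >⇒¬Triangle k+l<m (_ , _ , m≤k+l , _) = <⇒≱ k+l<m m≤k+l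

    ≡⇒Triangle : ∀ {l m} → l + m ≡ k → Triangle k l m
    ≡⇒Triangle {l} {m} refl =
      ≤-refl , ≤-trans (m≤m+n l m) (m≤m+n (l + m) m) , ≤-trans (m≤n+m m l) (m≤m+n (l + m) l) ,
      Even-double (l + m)

    private
      suc+suc+ : ∀ l m k → suc l + suc m + k ≡ 2 + (l + m + k)
      suc+suc+ = solve-∀

    Triangle-suc⁺ : ∀ {l m} → Triangle k l m → Triangle k (suc l) (suc m)
    Triangle-suc⁺ {l} {m} (k≤l+m , l≤k+m , m≤k+l , even) =
      ≤-trans k≤l+m (+-mono-≤ (n≤1+n l) (n≤1+n m)) ,
      subst (suc l ≤_) (sym (+-suc k m)) (s≤s l≤k+m) ,
      subst (suc m ≤_) (sym (+-suc k l)) (s≤s m≤k+l) ,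
      Even-transfer 0 1 (suc+suc+ l m k) even

    Triangle-suc⁻ : ∀ {l m} → k ≤ l + m → Triangle k (suc l) (suc m) → Triangle k l m
    Triangle-suc⁻ {l} {m} k≤l+m (_ , l<k+m , m<k+l , even) =
      k≤l+m ,
      ≤-pred (subst (suc l ≤_) (+-suc k m) l<k+m) ,
      ≤-pred (subst (suc m ≤_) (+-suc k l) m<k+l) ,
      Even-transfer 1 0 (sym (suc+suc+ l m k)) even

    Triangle-suc-cases : ∀ {l m} → Triangle k (suc l) (suc m) → Triangle k l m ⊎ 2 + (l + m) ≡ k
    Triangle-suc-cases {l} {m} t@(k≤2+l+m , _ , _ , even) with k ≤? l + m
    ... | yes k≤l+m = inj₁ (Triangle-suc⁻ k≤l+m t)
    ... | no  k≰l+m with m≤n⇒m<n∨m≡n (≰⇒> k≰l+m)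
    ...   | inj₁ 1+l+m<k = inj₂ (≤-antisym 1+l+m<k (subst (k ≤_) (+-suc (suc l) m) k≤2+l+m))
    ...   | inj₂ refl    = contradiction (Even-transfer 0 0 (sym (odd l m)) even) (¬Even-odd (suc (l + m)))
      where
      odd : ∀ l m → suc l + suc m + suc (l + m) ≡ suc (suc (l + m) + suc (l + m))
      odd = solve-∀

    Triangle-+ : ∀ s {i j} → k ≤ i + j → Triangle k (s + i) (s + j) ⇔ Triangle k i j
    Triangle-+ zero    k≤i+j = mk⇔ id id
    Triangle-+ (suc s) {i} {j} k≤i+j = mk⇔
      (Equivalence.to (Triangle-+ s k≤i+j) ∘ Triangle-suc⁻ (≤-trans k≤i+j i+j≤))
      (Triangle-suc⁺ ∘ Equivalence.from (Triangle-+ s k≤i+j))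
      where
      i+j≤ : i + j ≤ (s + i) + (s + j)
      i+j≤ = +-mono-≤ (m≤n+m i s) (m≤n+m j s)

    Triangle-reflect : ∀ {l m n} → l ≤ k → m + n ≡ k + k → Triangle k l m → Triangle k l n
    Triangle-reflect {l} {m} {n} l≤k m+n≡k+k (k≤l+m , _ , m≤k+l , even) =
      k≤l+n , ≤-trans l≤k (m≤m+n k n) , n≤k+l , Even-transfer m k parity-eq even
      where
      k≤l+n : k ≤ l + n
      k≤l+n = +-cancelˡ-≤ k k (l + n) (begin
        k + k      ≡⟨ sym m+n≡k+k ⟩
        m + n      ≤⟨ +-monoˡ-≤ n m≤k+l ⟩
        k + l + n  ≡⟨ +-assoc k l n ⟩
        k + (l + n) ∎)
      n≤k+l : n ≤ k + l
      n≤k+l = +-cancelˡ-≤ m n (k + l) (begin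
        m + n        ≡⟨ m+n≡k+k ⟩
        k + k        ≤⟨ +-monoʳ-≤ k k≤l+m ⟩
        k + (l + m)  ≡⟨ swap k l m ⟩
        m + (k + l)  ∎)
        where
        swap : ∀ k l m → k + (l + m) ≡ m + (k + l)
        swap = solve-∀
      parity-eq : m + m + (l + n + k) ≡ k + k + (l + m + k)
      parity-eq = begin-equality
        m + m + (l + n + k)   ≡⟨ regroup m n l k ⟩
        (m + n) + (m + l + k) ≡⟨ cong (_+ (m + l + k)) m+n≡k+k ⟩
        (k + k) + (m + l + k) ≡⟨ cong (k + k +_) (cong (_+ k) (+-comm m l)) ⟩
        k + k + (l + m + k)   ∎
        where
        regroup : ∀ m n l k → m + m + (l + n + k) ≡ (m + n) + (m + l + k)
        regroup = solve-∀

    private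
      k+[K+x] : ∀ k x → k + (suc k + x) ≡ suc k + (k + x)
      k+[K+x] = solve-∀
      KK-parity : ∀ k i j → suc k + suc k + (i + j + k) ≡ suc k + i + (suc k + j) + k
      KK-parity = solve-∀

    Triangle-K+ : ∀ {i j} → i ≤ k + j → j ≤ k + i → Even (i + j + k) → Triangle k (suc k + i) (suc k + j)
    Triangle-K+ {i} {j} i≤k+j j≤k+i even =
      ≤-trans (n≤1+n k) (≤-trans (m≤m+n (suc k) i) (m≤m+n (suc k + i) (suc k + j))) ,
      subst (suc k + i ≤_) (sym (k+[K+x] k j)) (+-monoʳ-≤ (suc k) i≤k+j) ,
      subst (suc k + j ≤_) (sym (k+[K+x] k i)) (+-monoʳ-≤ (suc k) j≤k+i) ,
      Even-transfer 0 (suc k) (sym (KK-parity k i j)) even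

    Triangle-K+⁻ : ∀ {i j} → Triangle k (suc k + i) (suc k + j) → i ≤ k + j × Even (i + j + k)
    Triangle-K+⁻ {i} {j} (_ , K+i≤k+K+j , _ , even) =
      +-cancelˡ-≤ (suc k) i (k + j) (subst (suc k + i ≤_) (k+[K+x] k j) K+i≤k+K+j) ,
      Even-transfer (suc k) 0 (KK-parity k i j) even

    Triangle-block : ∀ {i j p} → k ≡ suc (j + p) →
      Triangle k (suc k + i) (suc k + j) ⇔ (Triangle k i j ⊎ Triangle k (suc k + i) p)
    Triangle-block {i} {j} {p} refl = mk⇔ to from
      where
      j≤k+i : j ≤ k + i
      j≤k+i = ≤-trans (≤-trans (m≤m+n j p) (n≤1+n (j + p))) (m≤m+n k i)
      p≤k : p ≤ k
      p≤k = ≤-trans (m≤n+m p j) (n≤1+n (j + p))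
      Kp-parity : ∀ i j p → suc p + suc p + (i + j + suc (j + p)) ≡ suc (suc (j + p)) + i + p + suc (j + p)
      Kp-parity = solve-∀

      i<p : ¬ k ≤ i + j → Even (i + j + k) → i < p
      i<p k≰i+j even with m≤n⇒m<n∨m≡n (+-cancelʳ-≤ j i p (subst (i + j ≤_) (+-comm j p) (≤-pred (≰⇒> k≰i+j))))
      ... | inj₁ i<p  = i<p
      ... | inj₂ refl = contradiction (Even-transfer 0 0 (odd i j) even) (¬Even-odd (i + j))
        where
        odd : ∀ i j → suc (i + j + (i + j)) ≡ i + j + suc (j + i)
        odd = solve-∀

      to : Triangle k (suc k + i) (suc k + j) → Triangle k i j ⊎ Triangle k (suc k + i) p
      to t with Triangle-K+⁻ t | k ≤? i + j
      ... | i≤k+j , even | yes k≤i+j = inj₁ (k≤i+j , i≤k+j , j≤k+i , even)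
      ... | _     , even | no  k≰i+j =
        inj₂ (≤-trans (n≤1+n k) (≤-trans (m≤m+n (suc k) i) (m≤m+n (suc k + i) p)) ,
              +-monoʳ-< k (i<p k≰i+j even) ,
              ≤-trans p≤k (m≤m+n k (suc k + i)) ,
              Even-transfer 0 (suc p) (sym (Kp-parity i j p)) even)

      from : Triangle k i j ⊎ Triangle k (suc k + i) p → Triangle k (suc k + i) (suc k + j)
      from (inj₁ (_ , i≤k+j , _ , even))          = Triangle-K+ i≤k+j j≤k+i even
      from (inj₂ (_ , K+i≤k+p , _ , even)) = Triangle-K+ i≤k+j j≤k+i (Even-transfer (suc p) 0 (Kp-parity i j p) even)
        where
        i≤k+j : i ≤ k + j
        i≤k+j = ≤-trans (<⇒≤ (+-cancelˡ-< k i p K+i≤k+p)) (≤-trans p≤k (m≤m+n k j))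

    Triangle-block-disjoint : ∀ {i j p} → k ≡ suc (j + p) → ¬ (Triangle k i j × Triangle k (suc k + i) p)
    Triangle-block-disjoint {i} {j} {p} refl ((k≤i+j , _) , (_ , K+i≤k+p , _)) =
      <⇒≱ (s≤s (subst (i + j ≤_) (+-comm p j) (+-monoˡ-≤ j (<⇒≤ (+-cancelˡ-< k i p K+i≤k+p))))) k≤i+j

  punchIn : ℕ → ℕ → ℕ
  punchIn zero    q       = suc q
  punchIn (suc j) zero    = zero
  punchIn (suc j) (suc q) = suc (punchIn j q)

  punchOut : ℕ → ℕ → ℕ
  punchOut zero    zero    = zero
  punchOut zero    (suc q) = q
  punchOut (suc j) zero    = zero
  punchOut (suc j) (suc q) = suc (punchOut j q)

  punchInᵢ≢i : ∀ j q → punchIn j q ≢ j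
  punchInᵢ≢i zero    q       ()
  punchInᵢ≢i (suc j) zero    ()
  punchInᵢ≢i (suc j) (suc q) eq = punchInᵢ≢i j q (suc-injective eq)

  punchIn-injective : ∀ j a b → punchIn j a ≡ punchIn j b → a ≡ b
  punchIn-injective zero    a       b       eq = suc-injective eq
  punchIn-injective (suc j) zero    zero    eq = refl
  punchIn-injective (suc j) (suc a) (suc b) eq = cong suc (punchIn-injective j a b (suc-injective eq))

  punchIn-punchOut : ∀ {j q} → j ≢ q → punchIn j (punchOut j q) ≡ q
  punchIn-punchOut {zero}  {zero}  j≢q = ⊥-elim (j≢q refl)
  punchIn-punchOut {zero}  {suc q} j≢q = refl
  punchIn-punchOut {suc j} {zero}  j≢q = refl
  punchIn-punchOut {suc j} {suc q} j≢q = cong suc (punchIn-punchOut (j≢q ∘ cong suc))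

  punchIn-bounded : ∀ {j n} q → q < n → punchIn j q < suc n
  punchIn-bounded {zero}  q       q<n       = s≤s q<n
  punchIn-bounded {suc j} zero    q<n       = s≤s z≤n
  punchIn-bounded {suc j} (suc q) (s≤s q<n) = s≤s (punchIn-bounded q q<n)

  punchOut-< : ∀ {n j q} → j ≢ q → j < suc n → q < suc n → punchOut j q < n
  punchOut-< {_}     {zero}  {zero}  j≢q _ _ = ⊥-elim (j≢q refl)
  punchOut-< {_}     {zero}  {suc q} _ _ (s≤s q<n) = q<n
  punchOut-< {suc n} {suc j} {zero}  _ _ _ = s≤s z≤n
  punchOut-< {suc n} {suc j} {suc q} j≢q (s≤s j<) (s≤s q<) = s≤s (punchOut-< (j≢q ∘ cong suc) j< q<)
  punchOut-< {zero}  {suc j} {_}     _ (s≤s ()) _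

  punchIn-≥ : ∀ {j q} → j ≤ q → punchIn j q ≡ suc q
  punchIn-≥ {zero}  _         = refl
  punchIn-≥ {suc j} (s≤s j≤q) = cong suc (punchIn-≥ j≤q)

  punchIn-< : ∀ {j q} → q < j → punchIn j q ≡ q
  punchIn-< {suc j} {zero}  _         = refl
  punchIn-< {suc j} {suc q} (s≤s q<j) = cong suc (punchIn-< q<j)

  swap : ℕ → ℕ → ℕ
  swap zero    zero          = 1
  swap zero    (suc zero)    = 0
  swap zero    (suc (suc j)) = suc (suc j)
  swap (suc p) zero          = zero
  swap (suc p) (suc j)       = suc (swap p j)

  swap-self : ∀ p → swap p p ≡ suc p
  swap-self zero    = refl
  swap-self (suc p) = cong suc (swap-self p)

  swap-suc : ∀ p → swap p (suc p) ≡ p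
  swap-suc zero    = refl
  swap-suc (suc p) = cong suc (swap-suc p)

  swap-other : ∀ {p j} → j ≢ p → j ≢ suc p → swap p j ≡ j
  swap-other {zero}  {zero}        j≢p _      = ⊥-elim (j≢p refl)
  swap-other {zero}  {suc zero}    _   j≢1+p  = ⊥-elim (j≢1+p refl)
  swap-other {zero}  {suc (suc j)} _   _      = refl
  swap-other {suc p} {zero}        _   _      = refl
  swap-other {suc p} {suc j}       j≢p j≢1+p  = cong suc (swap-other (j≢p ∘ cong suc) (j≢1+p ∘ cong suc))

  swap-punchIn : ∀ p c → swap p (punchIn p c) ≡ punchIn (suc p) c
  swap-punchIn zero    zero    = refl
  swap-punchIn zero    (suc c) = refl
  swap-punchIn (suc p) zero    = refl
  swap-punchIn (suc p) (suc c) = cong suc (swap-punchIn p c)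

  swap-punchIn-suc : ∀ p c → swap p (punchIn (suc p) c) ≡ punchIn p c
  swap-punchIn-suc zero    zero    = refl
  swap-punchIn-suc zero    (suc c) = refl
  swap-punchIn-suc (suc p) zero    = refl
  swap-punchIn-suc (suc p) (suc c) = cong suc (swap-punchIn-suc p c)

  swap-punchIn-other : ∀ {p j} c → j ≢ p → j ≢ suc p → swap p (punchIn j c) ≡ punchIn j (swap (punchOut j p) c)
  swap-punchIn-other {zero}  {zero}        c             j≢p _     = ⊥-elim (j≢p refl)
  swap-punchIn-other {suc p} {zero}        c             _   _     = refl
  swap-punchIn-other {zero}  {suc zero}    c             _   j≢1+p = ⊥-elim (j≢1+p refl)
  swap-punchIn-other {zero}  {suc (suc j)} zero          _   _     = refl
  swap-punchIn-other {zero}  {suc (suc j)} (suc zero)    _   _     = refl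
  swap-punchIn-other {zero}  {suc (suc j)} (suc (suc c)) _   _     = refl
  swap-punchIn-other {suc p} {suc j}       zero          _   _     = refl
  swap-punchIn-other {suc p} {suc j}       (suc c)       j≢p j≢1+p =
    cong suc (swap-punchIn-other c (j≢p ∘ cong suc) (j≢1+p ∘ cong suc))

  punchOut-suc : ∀ {j p} → j ≢ p → j ≢ suc p → punchOut j (suc p) ≡ suc (punchOut j p)
  punchOut-suc {zero}        {zero}  j≢p _     = ⊥-elim (j≢p refl)
  punchOut-suc {zero}        {suc p} _   _     = refl
  punchOut-suc {suc zero}    {zero}  _   j≢1+p = ⊥-elim (j≢1+p refl)
  punchOut-suc {suc (suc j)} {zero}  _   _     = refl
  punchOut-suc {suc j}       {suc p} j≢p j≢1+p = cong suc (punchOut-suc (j≢p ∘ cong suc) (j≢1+p ∘ cong suc))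

module Determinant {c ℓ : Level} (R : CommutativeRing c ℓ) where
  open CommutativeRing R hiding (zero)
  open import Algebra.Properties.Ring ring using (-0#≈0#; -‿involutive; -‿injective; -‿+-comm; -‿distribˡ-*; -‿distribʳ-*)
  open import Algebra.Solver.Ring.NaturalCoefficients.Default commutativeSemiring using (solve; _:=_; _:+_; _:*_)
  open import Algebra.Properties.CommutativeSemigroup +-commutativeSemigroup
    using () renaming (interchange to +-interchange; x∙yz≈y∙xz to x+[y+z]≈y+[x+z])
  open import Relation.Binary.Reasoning.Setoid setoid

  -1^_ : ℕ → Carrier
  -1^_ = sgn R

  -1^-+ : ∀ m n → -1^ (m ℕ.+ n) ≈ -1^ m * -1^ n
  -1^-+ zero    n = sym (*-identityˡ (-1^ n))
  -1^-+ (suc m) n = trans (-‿cong (-1^-+ m n)) (-‿distribˡ-* (-1^ m) (-1^ n))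

  𝟙 : ∀ {p} {P : Set p} → Dec P → Carrier
  𝟙 (yes _) = 1#
  𝟙 (no _)  = 0#

  𝟙-yes : ∀ {p} {P : Set p} (d : Dec P) → P → 𝟙 d ≈ 1#
  𝟙-yes (yes _) _  = refl
  𝟙-yes (no ¬p) p  = ⊥-elim (¬p p)

  𝟙-no : ∀ {p} {P : Set p} (d : Dec P) → ¬ P → 𝟙 d ≈ 0#
  𝟙-no (yes p) ¬p = ⊥-elim (¬p p)
  𝟙-no (no _)  _  = refl

  𝟙-yes-* : ∀ {p} {P : Set p} (d : Dec P) {x} → P → 𝟙 d * x ≈ x
  𝟙-yes-* d p = trans (*-congʳ (𝟙-yes d p)) (*-identityˡ _)

  𝟙-no-* : ∀ {p} {P : Set p} (d : Dec P) {x} → ¬ P → 𝟙 d * x ≈ 0#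
  𝟙-no-* d ¬p = trans (*-congʳ (𝟙-no d ¬p)) (zeroˡ _)

  𝟙-cong : ∀ {p q} {P : Set p} {Q : Set q} → P ⇔ Q → (d : Dec P) (e : Dec Q) → 𝟙 d ≈ 𝟙 e
  𝟙-cong P⇔Q (yes p) e = sym (𝟙-yes e (Equivalence.to P⇔Q p))
  𝟙-cong P⇔Q (no ¬p) e = sym (𝟙-no e (¬p ∘ Equivalence.from P⇔Q))

  𝟙-⊎ : ∀ {p q s} {P : Set p} {Q : Set q} {S : Set s} → P ⇔ (Q ⊎ S) → ¬ (Q × S) →
        (d : Dec P) (e : Dec Q) (f : Dec S) → 𝟙 d ≈ 𝟙 e + 𝟙 f
  𝟙-⊎ P⇔Q⊎S _ (no ¬p) e f = sym (trans (+-cong (𝟙-no e (¬p ∘ Equivalence.from P⇔Q⊎S ∘ inj₁))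
                                                  (𝟙-no f (¬p ∘ Equivalence.from P⇔Q⊎S ∘ inj₂)))
                                          (+-identityʳ 0#))
  𝟙-⊎ P⇔Q⊎S disjoint (yes p) e f with Equivalence.to P⇔Q⊎S p
  ... | inj₁ q = sym (trans (+-cong (𝟙-yes e q) (𝟙-no f λ s → disjoint (q , s))) (+-identityʳ 1#))
  ... | inj₂ s = sym (trans (+-cong (𝟙-no e λ q → disjoint (q , s)) (𝟙-yes f s)) (+-identityˡ 1#))

  -- Opaque, so that unification meets ∑< n f itself rather than its unfolding and can infer f.
  opaque
    ∑< : ℕ → (ℕ → Carrier) → Carrier
    ∑< zero    f = 0#
    ∑< (suc n) f = f 0 + ∑< n (f ∘ suc)

    syntax ∑< n (λ j → e) = ∑[ j < n ] e

    ∑-suc : ∀ n (f : ℕ → Carrier) → ∑< (suc n) f ≡ f 0 + ∑< n (f ∘ suc)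
    ∑-suc n f = ≡.refl

    ∑-one : ∀ (f : ℕ → Carrier) → ∑< 1 f ≈ f 0
    ∑-one f = +-identityʳ (f 0)

    ∑-cong : ∀ n {f g : ℕ → Carrier} → (∀ j → j < n → f j ≈ g j) → ∑< n f ≈ ∑< n g
    ∑-cong zero    _ = refl
    ∑-cong (suc n) f≈g = +-cong (f≈g 0 (s≤s z≤n)) (∑-cong n (λ j j<n → f≈g (suc j) (s≤s j<n)))

    ∑-zero : ∀ n {f : ℕ → Carrier} → (∀ j → j < n → f j ≈ 0#) → ∑< n f ≈ 0#
    ∑-zero zero    _ = refl
    ∑-zero (suc n) f≈0 = trans (+-cong (f≈0 0 (s≤s z≤n)) (∑-zero n (λ j j<n → f≈0 (suc j) (s≤s j<n))))
                               (+-identityʳ 0#)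

    ∑-distrib-+ : ∀ n (f g : ℕ → Carrier) → ∑[ j < n ] (f j + g j) ≈ ∑< n f + ∑< n g
    ∑-distrib-+ zero    f g = sym (+-identityˡ 0#)
    ∑-distrib-+ (suc n) f g = trans (+-congˡ (∑-distrib-+ n (f ∘ suc) (g ∘ suc))) (+-interchange _ _ _ _)

    *-distribˡ-∑ : ∀ n x (f : ℕ → Carrier) → x * ∑< n f ≈ ∑[ j < n ] (x * f j)
    *-distribˡ-∑ zero    x f = zeroʳ x
    *-distribˡ-∑ (suc n) x f = trans (distribˡ x (f 0) (∑< n (f ∘ suc))) (+-congˡ (*-distribˡ-∑ n x (f ∘ suc)))

    ∑-comm : ∀ m n (f : ℕ → ℕ → Carrier) → ∑[ i < m ] ∑[ j < n ] f i j ≈ ∑[ j < n ] ∑[ i < m ] f i j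
    ∑-comm zero    n f = sym (∑-zero n (λ _ _ → refl))
    ∑-comm (suc m) n f = trans (+-congˡ (∑-comm m n (f ∘ suc))) (sym (∑-distrib-+ n (f 0) (λ j → ∑[ i < m ] f (suc i) j)))

    -‿distrib-∑ : ∀ n (f : ℕ → Carrier) → - ∑< n f ≈ ∑[ j < n ] (- f j)
    -‿distrib-∑ zero    f = -0#≈0#
    -‿distrib-∑ (suc n) f = trans (sym (-‿+-comm (f 0) (∑< n (f ∘ suc)))) (+-congˡ (-‿distrib-∑ n (f ∘ suc)))

    ∑-+ : ∀ m n (f : ℕ → Carrier) → ∑< (m ℕ.+ n) f ≈ ∑< m f + ∑[ j < n ] f (m ℕ.+ j)
    ∑-+ zero    n f = sym (+-identityˡ _)
    ∑-+ (suc m) n f = trans (+-congˡ (∑-+ m n (f ∘ suc))) (sym (+-assoc _ _ _))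

    ∑-last : ∀ n (f : ℕ → Carrier) → ∑< (suc n) f ≈ ∑< n f + f n
    ∑-last zero    f = trans (+-identityʳ (f 0)) (sym (+-identityˡ (f 0)))
    ∑-last (suc n) f = trans (+-congˡ (∑-last n (f ∘ suc))) (sym (+-assoc _ _ _))

    ∑-δ : ∀ n p {f : ℕ → Carrier} → p < n → (∀ j → j < n → j ≢ p → f j ≈ 0#) → ∑< n f ≈ f p
    ∑-δ (suc n) zero    _         f≈0 =
      trans (+-congˡ (∑-zero n (λ j j<n → f≈0 (suc j) (s≤s j<n) λ ()))) (+-identityʳ _)
    ∑-δ (suc n) (suc p) (s≤s p<n) f≈0 =
      trans (+-congʳ (f≈0 0 (s≤s z≤n) λ ()))
            (trans (+-identityˡ _) (∑-δ n p p<n (λ j j<n j≢p → f≈0 (suc j) (s≤s j<n) (j≢p ∘ ℕₚ.suc-injective))))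

    ∑-δ₂ : ∀ n p {f : ℕ → Carrier} → suc p < n → (∀ j → j < n → j ≢ p → j ≢ suc p → f j ≈ 0#) →
           ∑< n f ≈ f p + f (suc p)
    ∑-δ₂ (suc (suc n)) zero    _         f≈0 =
      trans (+-congˡ (+-congˡ (∑-zero n (λ j j<n → f≈0 (suc (suc j)) (s≤s (s≤s j<n)) (λ ()) (λ ())))))
            (+-congˡ (+-identityʳ _))
    ∑-δ₂ (suc n)       (suc p) (s≤s p<n) f≈0 =
      trans (+-congʳ (f≈0 0 (s≤s z≤n) (λ ()) (λ ())))
            (trans (+-identityˡ _) (∑-δ₂ n p p<n (λ j j<n j≢p j≢1+p →
              f≈0 (suc j) (s≤s j<n) (j≢p ∘ ℕₚ.suc-injective) (j≢1+p ∘ ℕₚ.suc-injective))))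

    ∑-swap : ∀ n p (f : ℕ → Carrier) → suc p < n → ∑[ j < n ] f (swap p j) ≈ ∑< n f
    ∑-swap (suc (suc n)) zero    f _         = x+[y+z]≈y+[x+z] _ _ _
    ∑-swap (suc n)       (suc p) f (s≤s p<n) = +-congˡ (∑-swap n p (f ∘ suc) p<n)

    sumFin≡∑< : ∀ n (f : ℕ → Carrier) → Defs.sumFin R n (f ∘ toℕ) ≡ ∑< n f
    sumFin≡∑< zero    f = ≡.refl
    sumFin≡∑< (suc n) f = ≡.cong (f 0 +_) (sumFin≡∑< n (f ∘ suc))

  -- Indexed by ℕ for easy shifting of blocks; det n only reads the entries in [0, n)².
  Matrix : Set c
  Matrix = ℕ → ℕ → Carrier

  transpose : Matrix → Matrix
  transpose M i j = M j i

  minor : Matrix → ℕ → Matrix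
  minor M j r q = M (suc r) (punchIn j q)

  det : ℕ → Matrix → Carrier
  det zero    M = 1#
  det (suc n) M = ∑[ j < suc n ] (-1^ j * (M 0 j * det n (minor M j)))

  laplaceTerm : ℕ → Matrix → ℕ → Carrier
  laplaceTerm n M j = -1^ j * (M 0 j * det n (minor M j))

  det-cong : ∀ n {M N : Matrix} → (∀ i j → i < n → j < n → M i j ≈ N i j) → det n M ≈ det n N
  det-cong zero    _   = refl
  det-cong (suc n) M≈N = ∑-cong (suc n) λ j j<1+n →
    *-congˡ (*-cong (M≈N 0 j (s≤s z≤n) j<1+n)
                    (det-cong n λ r q r<n q<n → M≈N (suc r) (punchIn j q) (s≤s r<n) (punchIn-bounded q q<n)))

  det-congᵖ : ∀ n {M N : Matrix} → (∀ i j → M i j ≈ N i j) → det n M ≈ det n N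
  det-congᵖ n M≈N = det-cong n (λ i j _ _ → M≈N i j)

  sumFin-cong : ∀ n {f g : Fin n → Carrier} → (∀ i → f i ≈ g i) → Defs.sumFin R n f ≈ Defs.sumFin R n g
  sumFin-cong zero    _   = refl
  sumFin-cong (suc n) f≈g = +-cong (f≈g fzero) (sumFin-cong n (f≈g ∘ fsuc))

  Defs-det-cong : ∀ n {M N : Fin n → Fin n → Carrier} → (∀ i j → M i j ≈ N i j) → Defs.det R n M ≈ Defs.det R n N
  Defs-det-cong zero    _   = refl
  Defs-det-cong (suc n) {M} {N} M≈N =
    sumFin-cong (suc n) {f = λ j → sgn R (toℕ j) * (M fzero j * Defs.det R n (Fin-minor M j))}
                        {g = λ j → sgn R (toℕ j) * (N fzero j * Defs.det R n (Fin-minor N j))}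
      λ j → *-congˡ (*-cong (M≈N fzero j) (Defs-det-cong n λ r q → M≈N (fsuc r) (Fin.punchIn j q)))
    where
    Fin-minor : (Fin (suc n) → Fin (suc n) → Carrier) → Fin (suc n) → Fin n → Fin n → Carrier
    Fin-minor M j r q = M (fsuc r) (Fin.punchIn j q)

  toℕ-punchIn : ∀ {n} (j : Fin (suc n)) (q : Fin n) → toℕ (Fin.punchIn j q) ≡ punchIn (toℕ j) (toℕ q)
  toℕ-punchIn fzero    q        = ≡.refl
  toℕ-punchIn (fsuc j) fzero    = ≡.refl
  toℕ-punchIn (fsuc j) (fsuc q) = ≡.cong suc (toℕ-punchIn j q)

  Defs-det≈det : ∀ n (M : Matrix) → Defs.det R n (λ i j → M (toℕ i) (toℕ j)) ≈ det n M
  Defs-det≈det zero    M = refl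
  Defs-det≈det (suc n) M = begin
    Defs.det R (suc n) (λ i j → M (toℕ i) (toℕ j))   ≈⟨ sumFin-cong (suc n) {f = Defs-term} {g = laplaceTerm n M ∘ toℕ}
                                                            (λ j → *-congˡ (*-congˡ (minor≈ j))) ⟩
    Defs.sumFin R (suc n) (laplaceTerm n M ∘ toℕ)     ≡⟨ sumFin≡∑< (suc n) (laplaceTerm n M) ⟩
    det (suc n) M                                     ∎
    where
    Defs-term : Fin (suc n) → Carrier
    Defs-term j = sgn R (toℕ j) * (M 0 (toℕ j) * Defs.det R n (λ r q → M (suc (toℕ r)) (toℕ (Fin.punchIn j q))))
    minor≈ : ∀ j → Defs.det R n (λ r q → M (suc (toℕ r)) (toℕ (Fin.punchIn j q))) ≈ det n (minor M (toℕ j))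
    minor≈ j = trans (Defs-det-cong n λ r q → reflexive (≡.cong (M (suc (toℕ r))) (toℕ-punchIn j q)))
                     (Defs-det≈det n (minor M (toℕ j)))

  -1^suc : ∀ p x → -1^ suc p * x ≈ - (-1^ p * x)
  -1^suc p x = sym (-‿distribˡ-* (-1^ p) x)

  -1^-flip : ∀ p x → -1^ p * x ≈ - (-1^ suc p * x)
  -1^-flip p x = trans (sym (-‿involutive _)) (-‿cong (sym (-1^suc p x)))

  det-minor-cong : ∀ n {M N : Matrix} q → (∀ i j → j ≢ q → M i j ≈ N i j) → det n (minor M q) ≈ det n (minor N q)
  det-minor-cong n q M≈N = det-congᵖ n λ r c → M≈N (suc r) (punchIn q c) (punchInᵢ≢i q c)

  det-linearᶜ : ∀ n {M M₁ M₂ : Matrix} q t → q < n →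
    (∀ i j → j ≢ q → M i j ≈ M₁ i j) → (∀ i j → j ≢ q → M i j ≈ M₂ i j) →
    (∀ i → M i q ≈ M₁ i q + t * M₂ i q) → det n M ≈ det n M₁ + t * det n M₂
  det-linearᶜ (suc n) {M} {M₁} {M₂} q t q<n M≈M₁ M≈M₂ Mq≈ = begin
    det (suc n) M                                                 ≈⟨ ∑-cong (suc n) termwise ⟩
    ∑[ j < suc n ] (laplaceTerm n M₁ j + t * laplaceTerm n M₂ j)  ≈⟨ ∑-distrib-+ (suc n) _ _ ⟩
    det (suc n) M₁ + ∑[ j < suc n ] (t * laplaceTerm n M₂ j)      ≈⟨ +-congˡ (*-distribˡ-∑ (suc n) t _) ⟨
    det (suc n) M₁ + t * det (suc n) M₂                           ∎
    where
    split-entry : ∀ s a b d → s * ((a + t * b) * d) ≈ s * (a * d) + t * (s * (b * d))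
    split-entry s a b d =
      solve 5 (λ s a b d t → s :* ((a :+ t :* b) :* d) := s :* (a :* d) :+ t :* (s :* (b :* d))) refl s a b d t
    split-minor : ∀ s a d₁ d₂ → s * (a * (d₁ + t * d₂)) ≈ s * (a * d₁) + t * (s * (a * d₂))
    split-minor s a d₁ d₂ =
      solve 5 (λ s a d₁ d₂ t → s :* (a :* (d₁ :+ t :* d₂)) := s :* (a :* d₁) :+ t :* (s :* (a :* d₂))) refl s a d₁ d₂ t
    termwise : ∀ j → j < suc n → laplaceTerm n M j ≈ laplaceTerm n M₁ j + t * laplaceTerm n M₂ j
    termwise j j<1+n with j ≟ q
    ... | yes ≡.refl = begin
      -1^ j * (M 0 j * det n (minor M j))                        ≈⟨ *-congˡ (*-congʳ (Mq≈ 0)) ⟩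
      -1^ j * ((M₁ 0 j + t * M₂ 0 j) * det n (minor M j))        ≈⟨ split-entry _ _ _ _ ⟩
      -1^ j * (M₁ 0 j * det n (minor M j)) + t * (-1^ j * (M₂ 0 j * det n (minor M j)))
        ≈⟨ +-cong (*-congˡ (*-congˡ (det-minor-cong n j M≈M₁)))
                  (*-congˡ (*-congˡ (*-congˡ (det-minor-cong n j M≈M₂)))) ⟩
      laplaceTerm n M₁ j + t * laplaceTerm n M₂ j                ∎
    ... | no j≢q = begin
      -1^ j * (M 0 j * det n (minor M j))                        ≈⟨ *-congˡ (*-congˡ minor-linear) ⟩
      -1^ j * (M 0 j * (det n (minor M₁ j) + t * det n (minor M₂ j))) ≈⟨ split-minor _ _ _ _ ⟩
      -1^ j * (M 0 j * det n (minor M₁ j)) + t * (-1^ j * (M 0 j * det n (minor M₂ j)))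
        ≈⟨ +-cong (*-congˡ (*-congʳ (M≈M₁ 0 j j≢q))) (*-congˡ (*-congˡ (*-congʳ (M≈M₂ 0 j j≢q)))) ⟩
      laplaceTerm n M₁ j + t * laplaceTerm n M₂ j                ∎
      where
      q′ = punchOut j q
      punchIn-q′ : punchIn j q′ ≡ q
      punchIn-q′ = punchIn-punchOut j≢q
      avoids-q : ∀ c → c ≢ q′ → punchIn j c ≢ q
      avoids-q c c≢q′ eq = c≢q′ (punchIn-injective j c q′ (≡.trans eq (≡.sym punchIn-q′)))
      minor-linear : det n (minor M j) ≈ det n (minor M₁ j) + t * det n (minor M₂ j)
      minor-linear = det-linearᶜ n q′ t (punchOut-< j≢q j<1+n q<n)
        (λ r c c≢q′ → M≈M₁ (suc r) (punchIn j c) (avoids-q c c≢q′))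
        (λ r c c≢q′ → M≈M₂ (suc r) (punchIn j c) (avoids-q c c≢q′))
        (λ r → ≡.subst (λ z → M (suc r) z ≈ M₁ (suc r) z + t * M₂ (suc r) z) (≡.sym punchIn-q′) (Mq≈ (suc r)))

  det-swap : ∀ n {M M′ : Matrix} p → suc p < n → (∀ i j → M′ i j ≈ M i (swap p j)) → det n M′ ≈ - det n M
  det-swap (suc n) {M} {M′} p 1+p<1+n M′≈ = begin
    det (suc n) M′                                ≈⟨ ∑-cong (suc n) termwise ⟩
    ∑[ j < suc n ] (- laplaceTerm n M (swap p j))  ≈⟨ -‿distrib-∑ (suc n) _ ⟨
    - ∑[ j < suc n ] laplaceTerm n M (swap p j)    ≈⟨ -‿cong (∑-swap (suc n) p (laplaceTerm n M) 1+p<1+n) ⟩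
    - det (suc n) M                               ∎
    where
    entry : ∀ i j {k} → swap p j ≡ k → M′ i j ≈ M i k
    entry i j eq = trans (M′≈ i j) (reflexive (≡.cong (M i) eq))
    termwise : ∀ j → j < suc n → laplaceTerm n M′ j ≈ - laplaceTerm n M (swap p j)
    termwise j j<1+n with j ≟ p | j ≟ suc p
    ... | yes ≡.refl | _ = begin
      -1^ j * (M′ 0 j * det n (minor M′ j))            ≈⟨ *-congˡ (*-cong (entry 0 j (swap-self j))
                                                            (det-congᵖ n λ r c → entry (suc r) (punchIn j c) (swap-punchIn j c))) ⟩
      -1^ j * (M 0 (suc j) * det n (minor M (suc j)))  ≈⟨ -1^-flip j _ ⟩
      - laplaceTerm n M (suc j)                        ≡⟨ ≡.cong (λ k → - laplaceTerm n M k) (swap-self j) ⟨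
      - laplaceTerm n M (swap j j)                     ∎
    ... | no _ | yes ≡.refl = begin
      -1^ suc p * (M′ 0 (suc p) * det n (minor M′ (suc p)))
        ≈⟨ *-congˡ (*-cong (entry 0 (suc p) (swap-suc p))
                           (det-congᵖ n λ r c → entry (suc r) (punchIn (suc p) c) (swap-punchIn-suc p c))) ⟩
      -1^ suc p * (M 0 p * det n (minor M p))  ≈⟨ -1^suc p _ ⟩
      - laplaceTerm n M p                      ≡⟨ ≡.cong (λ k → - laplaceTerm n M k) (swap-suc p) ⟨
      - laplaceTerm n M (swap p (suc p))       ∎
    ... | no j≢p | no j≢1+p = begin
      -1^ j * (M′ 0 j * det n (minor M′ j))     ≈⟨ *-congˡ (*-cong (entry 0 j (swap-other j≢p j≢1+p)) minor-swapped) ⟩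
      -1^ j * (M 0 j * - det n (minor M j))     ≈⟨ *-congˡ (-‿distribʳ-* _ _) ⟨
      -1^ j * - (M 0 j * det n (minor M j))     ≈⟨ -‿distribʳ-* _ _ ⟨
      - laplaceTerm n M j                       ≡⟨ ≡.cong (λ k → - laplaceTerm n M k) (swap-other j≢p j≢1+p) ⟨
      - laplaceTerm n M (swap p j)              ∎
      where
      p′ = punchOut j p
      1+p′<n : suc p′ < n
      1+p′<n = ≡.subst (_< n) (punchOut-suc j≢p j≢1+p) (punchOut-< j≢1+p j<1+n 1+p<1+n)
      minor-swapped : det n (minor M′ j) ≈ - det n (minor M j)
      minor-swapped = det-swap n p′ 1+p′<n λ r c → entry (suc r) (punchIn j c) (swap-punchIn-other c j≢p j≢1+p)

  -- The terms j = p and j = p + 1 cancel; every other minor still has two equal adjacent columns.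
  det-equal-adjacent : ∀ n {M : Matrix} p → suc p < n → (∀ i → M i p ≈ M i (suc p)) → det n M ≈ 0#
  det-equal-adjacent (suc n) {M} p 1+p<1+n Mp≈ = begin
    det (suc n) M                                          ≈⟨ ∑-δ₂ (suc n) p 1+p<1+n others-vanish ⟩
    laplaceTerm n M p + laplaceTerm n M (suc p)            ≈⟨ +-congˡ (-1^suc p _) ⟩
    laplaceTerm n M p + - (-1^ p * (M 0 (suc p) * det n (minor M (suc p))))
      ≈⟨ +-congˡ (-‿cong (*-congˡ (*-cong (sym (Mp≈ 0)) (det-congᵖ n λ r c → swapped-entry (suc r) c)))) ⟩
    laplaceTerm n M p + - laplaceTerm n M p                ≈⟨ -‿inverseʳ _ ⟩
    0#                                                     ∎
    where
    swapped-entry : ∀ i c → M i (punchIn (suc p) c) ≈ M i (punchIn p c)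
    swapped-entry i c with punchIn p c ≟ p | punchIn p c ≟ suc p
    ... | yes eq | _ = ⊥-elim (punchInᵢ≢i p c eq)
    ... | no _ | yes eq = begin
      M i (punchIn (suc p) c)          ≡⟨ ≡.cong (M i) (≡.sym (swap-punchIn p c)) ⟩
      M i (swap p (punchIn p c))       ≡⟨ ≡.cong (M i ∘ swap p) eq ⟩
      M i (swap p (suc p))             ≡⟨ ≡.cong (M i) (swap-suc p) ⟩
      M i p                            ≈⟨ Mp≈ i ⟩
      M i (suc p)                      ≡⟨ ≡.cong (M i) eq ⟨
      M i (punchIn p c)                ∎
    ... | no ≢p | no ≢1+p = reflexive (≡.cong (M i) (≡.trans (≡.sym (swap-punchIn p c)) (swap-other ≢p ≢1+p)))
    others-vanish : ∀ j → j < suc n → j ≢ p → j ≢ suc p → laplaceTerm n M j ≈ 0#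
    others-vanish j j<1+n j≢p j≢1+p = trans (*-congˡ (*-congˡ minor-vanishes)) (trans (*-congˡ (zeroʳ _)) (zeroʳ _))
      where
      p′ = punchOut j p
      1+p′≡ : punchOut j (suc p) ≡ suc p′
      1+p′≡ = punchOut-suc j≢p j≢1+p
      minor-vanishes : det n (minor M j) ≈ 0#
      minor-vanishes = det-equal-adjacent n p′ (≡.subst (_< n) 1+p′≡ (punchOut-< j≢1+p j<1+n 1+p<1+n)) λ r → begin
        M (suc r) (punchIn j p′)         ≡⟨ ≡.cong (M (suc r)) (punchIn-punchOut j≢p) ⟩
        M (suc r) p                      ≈⟨ Mp≈ (suc r) ⟩
        M (suc r) (suc p)                ≡⟨ ≡.cong (M (suc r)) (punchIn-punchOut j≢1+p) ⟨
        M (suc r) (punchIn j (punchOut j (suc p))) ≡⟨ ≡.cong (M (suc r) ∘ punchIn j) 1+p′≡ ⟩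
        M (suc r) (punchIn j (suc p′))   ∎

  -- Swapping columns q and q + 1 brings the equal pair closer and only changes the sign.
  det-equal-columns : ∀ n {M : Matrix} {p q} → p < q → q < n → (∀ i → M i p ≈ M i q) → det n M ≈ 0#
  det-equal-columns n {M} {p} {suc q} (s≤s p≤q) 1+q<n Mp≈Mq with ℕₚ.m≤n⇒m<n∨m≡n p≤q
  ... | inj₂ ≡.refl = det-equal-adjacent n p 1+q<n Mp≈Mq
  ... | inj₁ p<q    = -‿injective (trans (sym (det-swap n q 1+q<n λ _ _ → refl)) (trans swapped-vanishes (sym -0#≈0#)))
    where
    p≢q   = ℕₚ.<⇒≢ p<q
    p≢1+q = ℕₚ.<⇒≢ (ℕₚ.m<n⇒m<1+n p<q)
    swapped-vanishes : det n (λ i j → M i (swap q j)) ≈ 0#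
    swapped-vanishes = det-equal-columns n p<q (ℕₚ.<-trans (ℕₚ.n<1+n q) 1+q<n) λ i → begin
      M i (swap q p)   ≡⟨ ≡.cong (M i) (swap-other p≢q p≢1+q) ⟩
      M i p            ≈⟨ Mp≈Mq i ⟩
      M i (suc q)      ≡⟨ ≡.cong (M i) (swap-self q) ⟨
      M i (swap q q)   ∎

  setColumn : Matrix → ℕ → (ℕ → Carrier) → Matrix
  setColumn M q v i j with j ≟ q
  ... | yes _ = v i
  ... | no  _ = M i j

  setColumn-≡ : ∀ M q v i → setColumn M q v i q ≡ v i
  setColumn-≡ M q v i with q ≟ q
  ... | yes _  = ≡.refl
  ... | no q≢q = ⊥-elim (q≢q ≡.refl)

  setColumn-≢ : ∀ M {q} v i {j} → j ≢ q → setColumn M q v i j ≡ M i j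
  setColumn-≢ M {q} v i {j} j≢q with j ≟ q
  ... | yes j≡q = ⊥-elim (j≢q j≡q)
  ... | no  _   = ≡.refl

  det-add-column : ∀ n {M M′ : Matrix} {p q} t → p < n → q < n → p ≢ q →
    (∀ i j → j ≢ q → M′ i j ≈ M i j) → (∀ i → M′ i q ≈ M i q + t * M i p) → det n M′ ≈ det n M
  det-add-column n {M} {M′} {p} {q} t p<n q<n p≢q M′≈M M′q≈ = begin
    det n M′                ≈⟨ det-linearᶜ n q t q<n M′≈M M′≈Mp M′q≈Mp ⟩
    det n M + t * det n Mp  ≈⟨ +-congˡ (trans (*-congˡ Mp-vanishes) (zeroʳ t)) ⟩
    det n M + 0#            ≈⟨ +-identityʳ _ ⟩
    det n M                 ∎
    where
    Mp = setColumn M q (λ i → M i p)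
    M′≈Mp : ∀ i j → j ≢ q → M′ i j ≈ Mp i j
    M′≈Mp i j j≢q = trans (M′≈M i j j≢q) (reflexive (≡.sym (setColumn-≢ M _ i j≢q)))
    M′q≈Mp : ∀ i → M′ i q ≈ M i q + t * Mp i q
    M′q≈Mp i = trans (M′q≈ i) (+-congˡ (*-congˡ (reflexive (≡.sym (setColumn-≡ M q _ i)))))
    p≡q-columns : ∀ i → Mp i p ≈ Mp i q
    p≡q-columns i = reflexive (≡.trans (setColumn-≢ M _ i p≢q) (≡.sym (setColumn-≡ M q _ i)))
    Mp-vanishes : det n Mp ≈ 0#
    Mp-vanishes with ℕₚ.<-cmp p q
    ... | tri< p<q _ _ = det-equal-columns n p<q q<n p≡q-columns
    ... | tri≈ _ p≡q _ = ⊥-elim (p≢q p≡q)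
    ... | tri> _ _ q<p = det-equal-columns n q<p p<n (sym ∘ p≡q-columns)

  det-add-columns : ∀ n m {M M′ : Matrix} {q} (t : ℕ → Carrier) → m ≤ n → q < n → t q ≈ 0# →
    (∀ i j → j ≢ q → M′ i j ≈ M i j) → (∀ i → M′ i q ≈ M i q + ∑[ l < m ] (t l * M i l)) → det n M′ ≈ det n M
  det-add-columns n zero {M} {M′} {q} t _ _ _ M′≈M M′q≈ = det-congᵖ n M′≈
    where
    M′≈ : ∀ i j → M′ i j ≈ M i j
    M′≈ i j with j ≟ q
    ... | yes ≡.refl = trans (M′q≈ i) (trans (+-congˡ (∑-zero 0 λ _ ())) (+-identityʳ _))
    ... | no j≢q     = M′≈M i j j≢q
  det-add-columns n (suc m) {M} {M′} {q} t 1+m≤n q<n tq≈0 M′≈M M′q≈ =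
    trans (det-add-columns n m t (ℕₚ.<⇒≤ 1+m≤n) q<n tq≈0 M′≈M₁ M′q≈M₁) M₁≈M
    where
    M₁ = setColumn M q (λ i → M i q + t m * M i m)
    M′≈M₁ : ∀ i j → j ≢ q → M′ i j ≈ M₁ i j
    M′≈M₁ i j j≢q = trans (M′≈M i j j≢q) (reflexive (≡.sym (setColumn-≢ M _ i j≢q)))
    same-terms : ∀ i l → Dec (l ≡ q) → t l * M i l ≈ t l * M₁ i l
    same-terms i l (yes ≡.refl) = trans (*-congʳ tq≈0) (trans (zeroˡ _) (sym (trans (*-congʳ tq≈0) (zeroˡ _))))
    same-terms i l (no l≢q)     = *-congˡ (reflexive (≡.sym (setColumn-≢ M _ i l≢q)))
    M′q≈M₁ : ∀ i → M′ i q ≈ M₁ i q + ∑[ l < m ] (t l * M₁ i l)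
    M′q≈M₁ i = begin
      M′ i q                                                ≈⟨ M′q≈ i ⟩
      M i q + ∑[ l < suc m ] (t l * M i l)                  ≈⟨ +-congˡ (∑-last m _) ⟩
      M i q + (∑[ l < m ] (t l * M i l) + t m * M i m)      ≈⟨ +-congˡ (+-comm _ _) ⟩
      M i q + (t m * M i m + ∑[ l < m ] (t l * M i l))      ≈⟨ +-assoc _ _ _ ⟨
      M i q + t m * M i m + ∑[ l < m ] (t l * M i l)        ≈⟨ +-cong (reflexive (≡.sym (setColumn-≡ M q _ i)))
                                                                       (∑-cong m λ l _ → same-terms i l (l ≟ q)) ⟩
      M₁ i q + ∑[ l < m ] (t l * M₁ i l)                    ∎
    M₁≈M : det n M₁ ≈ det n M
    M₁≈M with m ≟ q
    ... | yes ≡.refl = det-congᵖ n λ i j → M₁≈ i j (j ≟ m)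
      where
      M₁≈ : ∀ i j → Dec (j ≡ m) → M₁ i j ≈ M i j
      M₁≈ i j (yes ≡.refl) =
        trans (reflexive (setColumn-≡ M j _ i)) (trans (+-congˡ (trans (*-congʳ tq≈0) (zeroˡ _))) (+-identityʳ _))
      M₁≈ i j (no j≢m)     = reflexive (setColumn-≢ M _ i j≢m)
    ... | no m≢q = det-add-column n (t m) 1+m≤n q<n m≢q (λ i j j≢q → reflexive (setColumn-≢ M _ i j≢q))
                                  (λ i → reflexive (setColumn-≡ M q _ i))

  mul : ℕ → Matrix → Matrix → Matrix
  mul n X Y i j = ∑[ l < n ] (X i l * Y l j)

  UpperUnitriangular : Matrix → Set ℓ
  UpperUnitriangular U = (∀ i j → j < i → U i j ≈ 0#) × (∀ i → U i i ≈ 1#)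

  splice : ℕ → Matrix → Matrix → Matrix
  splice t X Y i j with j <? t
  ... | yes _ = X i j
  ... | no  _ = Y i j

  splice-< : ∀ t X Y i {j} → j < t → splice t X Y i j ≡ X i j
  splice-< t X Y i {j} j<t with j <? t
  ... | yes _   = ≡.refl
  ... | no j≮t = ⊥-elim (j≮t j<t)

  splice-≥ : ∀ t X Y i {j} → ¬ j < t → splice t X Y i j ≡ Y i j
  splice-≥ t X Y i {j} j≮t with j <? t
  ... | yes j<t = ⊥-elim (j≮t j<t)
  ... | no  _   = ≡.refl

  -- Column t of X U is column t of X plus a combination of the columns l < t of X.
  det-splice-step : ∀ n X {U} → UpperUnitriangular U → ∀ {t} → t < n →
    det n (splice t X (mul n X U)) ≈ det n (splice (suc t) X (mul n X U))
  det-splice-step n X {U} (U-below , U-diag) {t} t<n =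
    det-add-columns n n coeff ℕₚ.≤-refl t<n (𝟙-no-* (t <? t) (ℕₚ.<-irrefl ≡.refl)) off-column column-t
    where
    Z  = splice t X (mul n X U)
    Z′ = splice (suc t) X (mul n X U)
    coeff : ℕ → Carrier
    coeff l = 𝟙 (l <? t) * U l t
    off-column : ∀ i j → j ≢ t → Z i j ≈ Z′ i j
    off-column i j j≢t with j <? t
    ... | yes j<t = reflexive (≡.sym (splice-< (suc t) X _ i (ℕₚ.m<n⇒m<1+n j<t)))
    ... | no  j≮t = reflexive (≡.sym (splice-≥ (suc t) X _ i λ j<1+t → j≮t (ℕₚ.≤∧≢⇒< (ℕₚ.≤-pred j<1+t) j≢t)))
    entry : ∀ i l → X i l * U l t ≈ 𝟙 (l ≟ t) * X i t + coeff l * Z′ i l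
    entry i l with ℕₚ.<-cmp l t
    ... | tri< l<t l≢t _ = sym (begin
      𝟙 (l ≟ t) * X i t + 𝟙 (l <? t) * U l t * Z′ i l
        ≈⟨ +-cong (𝟙-no-* (l ≟ t) l≢t)
                  (*-cong (𝟙-yes-* (l <? t) l<t) (reflexive (splice-< (suc t) X _ i (ℕₚ.m<n⇒m<1+n l<t)))) ⟩
      0# + U l t * X i l  ≈⟨ +-identityˡ _ ⟩
      U l t * X i l       ≈⟨ *-comm _ _ ⟩
      X i l * U l t       ∎)
    ... | tri≈ l≮t ≡.refl _ = begin
      X i l * U l l                                    ≈⟨ trans (*-congˡ (U-diag l)) (*-identityʳ _) ⟩
      X i l                                            ≈⟨ 𝟙-yes-* (l ≟ l) ≡.refl ⟨
      𝟙 (l ≟ l) * X i l                                ≈⟨ +-identityʳ _ ⟨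
      𝟙 (l ≟ l) * X i l + 0#                           ≈⟨ +-congˡ (trans (*-congʳ (𝟙-no-* (l <? l) l≮t)) (zeroˡ _)) ⟨
      𝟙 (l ≟ l) * X i l + 𝟙 (l <? l) * U l l * Z′ i l  ∎
    ... | tri> l≮t l≢t t<l = begin
      X i l * U l t        ≈⟨ trans (*-congˡ (U-below l t t<l)) (zeroʳ _) ⟩
      0#                   ≈⟨ +-identityʳ 0# ⟨
      0# + 0#              ≈⟨ +-cong (𝟙-no-* (l ≟ t) l≢t) (trans (*-congʳ (𝟙-no-* (l <? t) l≮t)) (zeroˡ _)) ⟨
      𝟙 (l ≟ t) * X i t + 𝟙 (l <? t) * U l t * Z′ i l ∎
    column-t : ∀ i → Z i t ≈ Z′ i t + ∑[ l < n ] (coeff l * Z′ i l)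
    column-t i = begin
      Z i t                                                              ≡⟨ splice-≥ t X _ i (ℕₚ.<-irrefl ≡.refl) ⟩
      ∑[ l < n ] (X i l * U l t)                                         ≈⟨ ∑-cong n (λ l _ → entry i l) ⟩
      ∑[ l < n ] (𝟙 (l ≟ t) * X i t + coeff l * Z′ i l)                  ≈⟨ ∑-distrib-+ n _ _ ⟩
      ∑[ l < n ] (𝟙 (l ≟ t) * X i t) + ∑[ l < n ] (coeff l * Z′ i l)
        ≈⟨ +-congʳ (∑-δ n t t<n λ l _ l≢t → 𝟙-no-* (l ≟ t) l≢t) ⟩
      𝟙 (t ≟ t) * X i t + ∑[ l < n ] (coeff l * Z′ i l)                  ≈⟨ +-congʳ (𝟙-yes-* (t ≟ t) ≡.refl) ⟩
      X i t + ∑[ l < n ] (coeff l * Z′ i l)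
        ≡⟨ ≡.cong (_+ ∑[ l < n ] (coeff l * Z′ i l)) (splice-< (suc t) X (mul n X U) i (ℕₚ.n<1+n t)) ⟨
      Z′ i t + ∑[ l < n ] (coeff l * Z′ i l)                             ∎

  det-mul-upperUnitriangular : ∀ n X {U} → UpperUnitriangular U → det n (mul n X U) ≈ det n X
  det-mul-upperUnitriangular n X {U} U-unitriangular =
    trans (det-congᵖ n λ i j → reflexive (≡.sym (splice-≥ 0 X (mul n X U) i λ ()))) (sweep n 0 (ℕₚ.+-identityʳ n))
    where
    sweep : ∀ d t → d ℕ.+ t ≡ n → det n (splice t X (mul n X U)) ≈ det n X
    sweep zero    t ≡.refl  = det-cong n λ i j _ j<t → reflexive (splice-< t X _ i j<t)
    sweep (suc d) t d+t≡n = trans (det-splice-step n X U-unitriangular (≡.subst (t <_) d+t≡n (s≤s (ℕₚ.m≤n+m t d))))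
                                  (sweep d (suc t) (≡.trans (ℕₚ.+-suc d t) d+t≡n))

  TransposeInvariant : ℕ → Set (c ⊔ ℓ)
  TransposeInvariant n = ∀ M → det n (transpose M) ≈ det n M

  det-by-column₀ : ∀ n → TransposeInvariant (suc n) → TransposeInvariant n → ∀ M →
    det (suc n) M ≈ ∑[ i < suc n ] (-1^ i * (M i 0 * det n (λ r q → M (punchIn i r) (suc q))))
  det-by-column₀ n T₁ T₀ M =
    trans (sym (T₁ M)) (∑-cong (suc n) λ i _ → *-congˡ (*-congˡ (T₀ (λ r q → M (punchIn i r) (suc q)))))

  -- Expand det M along row 0 and every minor along column 0, and compare with the column-0 expansion.
  transposeInvariant-step : ∀ n → TransposeInvariant (suc n) → TransposeInvariant n → TransposeInvariant (suc (suc n))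
  transposeInvariant-step n T₁ T₀ M = begin
    det (suc (suc n)) (transpose M)
      ≈⟨ ∑-cong (suc (suc n)) (λ i _ → *-congˡ (*-congˡ (T₁ (λ r q → M (punchIn i r) (suc q))))) ⟩
    ∑[ i < suc (suc n) ] column-term i                                   ≡⟨ ∑-suc (suc n) column-term ⟩
    column-term 0 + ∑[ i < suc n ] column-term (suc i)                   ≈⟨ +-congˡ tails ⟨
    laplaceTerm (suc n) M 0 + ∑[ j < suc n ] laplaceTerm (suc n) M (suc j) ≡⟨ ∑-suc (suc n) (laplaceTerm (suc n) M) ⟨
    det (suc (suc n)) M                                                  ∎
    where
    column-term : ℕ → Carrier
    column-term i = -1^ i * (M i 0 * det (suc n) (λ r q → M (punchIn i r) (suc q)))
    W : ℕ → ℕ → Carrier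
    W i j = det n (λ r q → M (suc (punchIn i r)) (suc (punchIn j q)))
    pull-in : ∀ a b f → a * (b * ∑< (suc n) f) ≈ ∑[ i < suc n ] (a * (b * f i))
    pull-in a b f = trans (*-congˡ (*-distribˡ-∑ (suc n) b f)) (*-distribˡ-∑ (suc n) a _)
    swap-signs : ∀ i j a b w → -1^ suc j * (a * (-1^ i * (b * w))) ≈ -1^ suc i * (b * (-1^ j * (a * w)))
    swap-signs i j a b w = trans (-1^suc j _) (trans (-‿cong (reorder (-1^ j) (-1^ i) a b w)) (sym (-1^suc i _)))
      where
      reorder : ∀ sj si a b w → sj * (a * (si * (b * w))) ≈ si * (b * (sj * (a * w)))
      reorder = solve 5 (λ sj si a b w → sj :* (a :* (si :* (b :* w))) := si :* (b :* (sj :* (a :* w)))) refl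
    tails : ∑[ j < suc n ] laplaceTerm (suc n) M (suc j) ≈ ∑[ i < suc n ] column-term (suc i)
    tails = begin
      ∑[ j < suc n ] laplaceTerm (suc n) M (suc j)
        ≈⟨ ∑-cong (suc n) (λ j _ → *-congˡ (*-congˡ (det-by-column₀ n T₁ T₀ (minor M (suc j))))) ⟩
      ∑[ j < suc n ] (-1^ suc j * (M 0 (suc j) * ∑[ i < suc n ] (-1^ i * (M (suc i) 0 * W i j))))
        ≈⟨ ∑-cong (suc n) (λ j _ → pull-in _ _ _) ⟩
      ∑[ j < suc n ] ∑[ i < suc n ] (-1^ suc j * (M 0 (suc j) * (-1^ i * (M (suc i) 0 * W i j))))
        ≈⟨ ∑-comm (suc n) (suc n) _ ⟩
      ∑[ i < suc n ] ∑[ j < suc n ] (-1^ suc j * (M 0 (suc j) * (-1^ i * (M (suc i) 0 * W i j))))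
        ≈⟨ ∑-cong (suc n) (λ i _ → ∑-cong (suc n) λ j _ → swap-signs i j _ _ _) ⟩
      ∑[ i < suc n ] ∑[ j < suc n ] (-1^ suc i * (M (suc i) 0 * (-1^ j * (M 0 (suc j) * W i j))))
        ≈⟨ ∑-cong (suc n) (λ i _ → pull-in _ _ _) ⟨
      ∑[ i < suc n ] column-term (suc i)
        ∎

  det-transpose : ∀ n → TransposeInvariant n
  det-transpose zero          M = refl
  det-transpose (suc zero)    M = ∑-cong 1 λ { zero _ → refl ; (suc _) (s≤s ()) }
  det-transpose (suc (suc n))   = transposeInvariant-step n (det-transpose (suc n)) (det-transpose n)

  LowerUnitriangular : Matrix → Set ℓ
  LowerUnitriangular L = UpperUnitriangular (transpose L)

  det-mul-lowerUnitriangular : ∀ n {L} X → LowerUnitriangular L → det n (mul n L X) ≈ det n X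
  det-mul-lowerUnitriangular n {L} X L-unitriangular = begin
    det n (mul n L X)                              ≈⟨ det-transpose n _ ⟨
    det n (transpose (mul n L X))                  ≈⟨ det-congᵖ n (λ i j → ∑-cong n λ l _ → *-comm _ _) ⟩
    det n (mul n (transpose X) (transpose L))      ≈⟨ det-mul-upperUnitriangular n (transpose X) L-unitriangular ⟩
    det n (transpose X)                            ≈⟨ det-transpose n X ⟩
    det n X                                        ∎

  det-blockUpper : ∀ a b (M : Matrix) → (∀ i j → i < a → a ≤ j → j < a ℕ.+ b → M i j ≈ 0#) →
    det (a ℕ.+ b) M ≈ det a M * det b (λ i j → M (a ℕ.+ i) (a ℕ.+ j))
  det-blockUpper zero    b M _   = sym (*-identityˡ _)
  det-blockUpper (suc a) b M M≈0 = begin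
    det (suc a ℕ.+ b) M                                                      ≈⟨ ∑-+ (suc a) b (laplaceTerm (a ℕ.+ b) M) ⟩
    ∑[ j < suc a ] laplaceTerm (a ℕ.+ b) M j + ∑[ j < b ] laplaceTerm (a ℕ.+ b) M (suc a ℕ.+ j)
      ≈⟨ +-cong (∑-cong (suc a) termwise) (∑-zero b λ j j<b → right-block-vanishes j j<b) ⟩
    ∑[ j < suc a ] (D * laplaceTerm a M j) + 0#                               ≈⟨ +-identityʳ _ ⟩
    ∑[ j < suc a ] (D * laplaceTerm a M j)                                    ≈⟨ *-distribˡ-∑ (suc a) D _ ⟨
    D * det (suc a) M                                                        ≈⟨ *-comm _ _ ⟩
    det (suc a) M * D                                                        ∎
    where
    D = det b (λ i j → M (suc a ℕ.+ i) (suc a ℕ.+ j))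
    termwise : ∀ j → j < suc a → laplaceTerm (a ℕ.+ b) M j ≈ D * laplaceTerm a M j
    termwise j (s≤s j≤a) = begin
      -1^ j * (M 0 j * det (a ℕ.+ b) (minor M j))
        ≈⟨ *-congˡ (*-congˡ (det-blockUpper a b (minor M j) minor-block)) ⟩
      -1^ j * (M 0 j * (det a (minor M j) * det b (λ r q → minor M j (a ℕ.+ r) (a ℕ.+ q))))
        ≈⟨ *-congˡ (*-congˡ (*-congˡ (det-congᵖ b λ r q →
             reflexive (≡.cong (M (suc a ℕ.+ r)) (punchIn-≥ (ℕₚ.≤-trans j≤a (ℕₚ.m≤m+n a q))))))) ⟩
      -1^ j * (M 0 j * (det a (minor M j) * D))
        ≈⟨ solve 4 (λ s m d e → s :* (m :* (d :* e)) := e :* (s :* (m :* d))) refl _ _ _ _ ⟩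
      D * laplaceTerm a M j ∎
      where
      minor-block : ∀ r q → r < a → a ≤ q → q < a ℕ.+ b → minor M j r q ≈ 0#
      minor-block r q r<a a≤q q<a+b = trans (reflexive (≡.cong (M (suc r)) (punchIn-≥ (ℕₚ.≤-trans j≤a a≤q))))
                                            (M≈0 (suc r) (suc q) (s≤s r<a) (s≤s a≤q) (s≤s q<a+b))
    right-block-vanishes : ∀ j → j < b → laplaceTerm (a ℕ.+ b) M (suc a ℕ.+ j) ≈ 0#
    right-block-vanishes j j<b =
      trans (*-congˡ (trans (*-congʳ (M≈0 0 (suc a ℕ.+ j) (s≤s z≤n) (ℕₚ.m≤m+n (suc a) j) (ℕₚ.+-monoʳ-< (suc a) j<b)))
                            (zeroˡ _)))
            (zeroʳ _)

  det-row₀-last : ∀ n (M : Matrix) → (∀ j → j < n → M 0 j ≈ 0#) → M 0 n ≈ 1# →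
    det (suc n) M ≈ -1^ n * det n (minor M n)
  det-row₀-last n M M₀≈0 M₀ₙ≈1 = begin
    det (suc n) M                        ≈⟨ ∑-δ (suc n) n (ℕₚ.n<1+n n) (λ j j<1+n j≢n →
                                              trans (*-congˡ (trans (*-congʳ (M₀≈0 j (ℕₚ.≤∧≢⇒< (ℕₚ.≤-pred j<1+n) j≢n))) (zeroˡ _)))
                                                    (zeroʳ _)) ⟩
    -1^ n * (M 0 n * det n (minor M n))  ≈⟨ *-congˡ (trans (*-congʳ M₀ₙ≈1) (*-identityˡ _)) ⟩
    -1^ n * det n (minor M n)            ∎

  det-antitriangular : ∀ n (M : Matrix) → (∀ i j → i ℕ.+ j < n → M i j ≈ 0#) → (∀ i j → i ℕ.+ j ≡ n → M i j ≈ 1#) →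
    det (suc n) M ≈ -1^ (suc n C 2)
  det-antitriangular zero    M _   M≈1 = trans (det-row₀-last 0 M (λ _ ()) (M≈1 0 0 ≡.refl)) (*-identityˡ 1#)
  det-antitriangular (suc m) M M≈0 M≈1 = begin
    det (suc (suc m)) M                        ≈⟨ det-row₀-last (suc m) M (M≈0 0) (M≈1 0 (suc m) ≡.refl) ⟩
    -1^ suc m * det (suc m) (minor M (suc m))  ≈⟨ *-congˡ (det-antitriangular m (minor M (suc m)) minor≈0 minor≈1) ⟩
    -1^ suc m * -1^ (suc m C 2)                ≈⟨ -1^-+ (suc m) (suc m C 2) ⟨
    -1^ (suc m ℕ.+ suc m C 2)                  ≡⟨ ≡.cong -1^_ pascal ⟩
    -1^ (suc (suc m) C 2)                      ∎
    where
    pascal : suc m ℕ.+ suc m C 2 ≡ suc (suc m) C 2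
    pascal = ≡.trans (≡.cong (ℕ._+ suc m C 2) (≡.sym (nC1≡n (suc m)))) (nCk+nC[k+1]≡[n+1]C[k+1] (suc m) 1)
    q<1+m : ∀ r q → r ℕ.+ q ≤ m → q < suc m
    q<1+m r q r+q≤m = s≤s (ℕₚ.≤-trans (ℕₚ.m≤n+m q r) r+q≤m)
    minor≈0 : ∀ r q → r ℕ.+ q < m → minor M (suc m) r q ≈ 0#
    minor≈0 r q r+q<m =
      trans (reflexive (≡.cong (M (suc r)) (punchIn-< (q<1+m r q (ℕₚ.<⇒≤ r+q<m))))) (M≈0 (suc r) q (s≤s r+q<m))
    minor≈1 : ∀ r q → r ℕ.+ q ≡ m → minor M (suc m) r q ≈ 1#
    minor≈1 r q r+q≡m =
      trans (reflexive (≡.cong (M (suc r)) (punchIn-< (q<1+m r q (ℕₚ.≤-reflexive r+q≡m))))) (M≈1 (suc r) q (≡.cong suc r+q≡m))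

  det-zeroRow : ∀ n (M : Matrix) → (∀ j → j < suc n → M 0 j ≈ 0#) → det (suc n) M ≈ 0#
  det-zeroRow n M M₀≈0 = ∑-zero (suc n) λ j j<1+n → trans (*-congˡ (trans (*-congʳ (M₀≈0 j j<1+n)) (zeroˡ _))) (zeroʳ _)

module Hankel {c ℓ : Level} (R : CommutativeRing c ℓ) (x : CommutativeRing.Carrier R) (k : ℕ) where
  open CommutativeRing R hiding (zero)
  open Determinant R
  open import Algebra.Solver.Ring.NaturalCoefficients.Default commutativeSemiring using (solve; _:=_; _:+_; _:*_)
  open import Algebra.Properties.Ring ring using (-0#≈0#; x[y-z]≈xy-xz)
  open import Relation.Binary.Reasoning.Setoid setoid

  A : Matrix
  A = a R (λ _ → x)

  J : (ℕ → Carrier) → ℕ → Carrier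
  J u zero    = x * u 0 + u 1
  J u (suc l) = u l + x * u (suc l) + u (suc (suc l))

  A-suc : ∀ n l → A (suc n) l ≡ J (A n) l
  A-suc n zero    = ≡.refl
  A-suc n (suc l) = ≡.refl

  J-cong : ∀ {u v} → (∀ l → u l ≈ v l) → ∀ l → J u l ≈ J v l
  J-cong u≈v zero    = +-cong (*-congˡ (u≈v 0)) (u≈v 1)
  J-cong u≈v (suc l) = +-cong (+-cong (u≈v l) (*-congˡ (u≈v (suc l)))) (u≈v (suc (suc l)))

  A-upper : ∀ {n l} → n < l → A n l ≈ 0#
  A-upper {zero}  {suc l} _         = refl
  A-upper {suc n} {suc l} (s≤s n<l) =
    trans (+-cong (+-cong (A-upper n<l) (trans (*-congˡ (A-upper (ℕₚ.m<n⇒m<1+n n<l))) (zeroʳ x)))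
                  (A-upper (ℕₚ.m<n⇒m<1+n (ℕₚ.m<n⇒m<1+n n<l))))
          (trans (+-identityʳ _) (+-identityʳ 0#))

  A-diagonal : ∀ n → A n n ≈ 1#
  A-diagonal zero    = refl
  A-diagonal (suc n) = trans (+-cong (+-cong (A-diagonal n) (trans (*-congˡ (A-upper (ℕₚ.n<1+n n))) (zeroʳ x)))
                                     (A-upper (ℕₚ.m<n⇒m<1+n (ℕₚ.n<1+n n))))
                             (trans (+-identityʳ _) (+-identityʳ 1#))

  A-lowerUnitriangular : LowerUnitriangular A
  A-lowerUnitriangular = (λ i j j<i → A-upper j<i) , A-diagonal

  T : Matrix
  T l m = 𝟙 (triangle? k l m)

  T-sym : ∀ l m → T l m ≈ T m l
  T-sym l m = 𝟙-cong (mk⇔ Triangle-sym Triangle-sym) (triangle? k l m) (triangle? k m l)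

  T-zeroˡ : ∀ m → T 0 m ≈ 𝟙 (m ≟ k)
  T-zeroˡ m = 𝟙-cong (mk⇔ Triangle-zeroˡ ≡⇒Triangle) (triangle? k 0 m) (m ≟ k)

  T-suc : ∀ l m → T (suc l) (suc m) ≈ T l m + 𝟙 (suc (suc (l ℕ.+ m)) ≟ k)
  T-suc l m = 𝟙-⊎ (mk⇔ Triangle-suc-cases from) disjoint
                  (triangle? k (suc l) (suc m)) (triangle? k l m) (suc (suc (l ℕ.+ m)) ≟ k)
    where
    from : Triangle k l m ⊎ suc (suc (l ℕ.+ m)) ≡ k → Triangle k (suc l) (suc m)
    from (inj₁ t)   = Triangle-suc⁺ t
    from (inj₂ eq) = ≡⇒Triangle (≡.trans (≡.cong suc (ℕₚ.+-suc l m)) eq)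
    disjoint : ¬ (Triangle k l m × suc (suc (l ℕ.+ m)) ≡ k)
    disjoint (t , eq) = <⇒¬Triangle (≡.subst (l ℕ.+ m <_) eq (ℕₚ.m<n⇒m<1+n (ℕₚ.n<1+n (l ℕ.+ m)))) t

  J-T-commute : ∀ l m → J (λ l′ → T l′ m) l ≈ J (T l) m
  J-T-commute zero    zero    = +-congˡ (T-sym 1 0)
  J-T-commute zero    (suc m) = begin
    x * T 0 (suc m) + T 1 (suc m)                          ≈⟨ +-congˡ (T-suc 0 m) ⟩
    x * T 0 (suc m) + (T 0 m + 𝟙 (suc (suc m) ≟ k))        ≈⟨ +-congˡ (+-congˡ (T-zeroˡ (suc (suc m)))) ⟨
    x * T 0 (suc m) + (T 0 m + T 0 (suc (suc m)))          ≈⟨ solve 3 (λ a b c → a :+ (b :+ c) := b :+ a :+ c) refl _ _ _ ⟩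
    T 0 m + x * T 0 (suc m) + T 0 (suc (suc m))            ∎
  J-T-commute (suc l) zero    = begin
    J (λ l′ → T l′ 0) (suc l)       ≈⟨ J-cong (λ l′ → T-sym l′ 0) (suc l) ⟩
    J (T 0) (suc l)                 ≈⟨ J-T-commute zero (suc l) ⟨
    J (λ l′ → T l′ (suc l)) 0       ≈⟨ J-cong (λ l′ → T-sym l′ (suc l)) 0 ⟩
    J (T (suc l)) 0                 ∎
  J-T-commute (suc l) (suc m) = begin
    T l (suc m) + x * T (suc l) (suc m) + T (suc (suc l)) (suc m)
      ≈⟨ +-congˡ (T-suc (suc l) m) ⟩
    T l (suc m) + x * T (suc l) (suc m) + (T (suc l) m + δ (suc (suc (suc l ℕ.+ m))))
      ≈⟨ solve 4 (λ a b c d → a :+ b :+ (c :+ d) := c :+ b :+ (a :+ d)) refl _ _ _ _ ⟩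
    T (suc l) m + x * T (suc l) (suc m) + (T l (suc m) + δ (suc (suc (suc l ℕ.+ m))))
      ≈⟨ +-congˡ (+-congˡ (reflexive (≡.cong δ (≡.cong (suc ∘ suc) (≡.sym (ℕₚ.+-suc l m)))))) ⟩
    T (suc l) m + x * T (suc l) (suc m) + (T l (suc m) + δ (suc (suc (l ℕ.+ suc m))))
      ≈⟨ +-congˡ (T-suc l (suc m)) ⟨
    T (suc l) m + x * T (suc l) (suc m) + T (suc l) (suc (suc m))  ∎
    where
    δ : ℕ → Carrier
    δ n = 𝟙 (n ≟ k)

  -- The boundary terms sit on both sides, so that the induction step is a semiring identity.
  J-summation-by-parts : ∀ N u w →
    ∑[ l < suc N ] (J u l * w l) + u N * w (suc N) ≈ ∑[ l < suc N ] (u l * J w l) + u (suc N) * w N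
  J-summation-by-parts zero u w = begin
    ∑[ l < 1 ] (J u l * w l) + u 0 * w 1  ≈⟨ +-congʳ (∑-one _) ⟩
    (x * u 0 + u 1) * w 0 + u 0 * w 1
      ≈⟨ solve 5 (λ x u₀ u₁ w₀ w₁ → (x :* u₀ :+ u₁) :* w₀ :+ u₀ :* w₁ := u₀ :* (x :* w₀ :+ w₁) :+ u₁ :* w₀)
                 refl x _ _ _ _ ⟩
    u 0 * (x * w 0 + w 1) + u 1 * w 0    ≈⟨ +-congʳ (∑-one _) ⟨
    ∑[ l < 1 ] (u l * J w l) + u 1 * w 0  ∎
  J-summation-by-parts (suc N) u w = begin
    ∑[ l < suc (suc N) ] (J u l * w l) + u (suc N) * w (suc (suc N))
      ≈⟨ +-congʳ (∑-last (suc N) _) ⟩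
    ∑[ l < suc N ] (J u l * w l) + J u (suc N) * w (suc N) + u (suc N) * w (suc (suc N))
      ≈⟨ solve 7 (λ L a b c w₁ w₂ x → L :+ (a :+ x :* b :+ c) :* w₁ :+ b :* w₂
                                      := (L :+ a :* w₁) :+ (x :* b :* w₁ :+ c :* w₁ :+ b :* w₂))
               refl _ _ _ _ _ _ x ⟩
    ∑[ l < suc N ] (J u l * w l) + u N * w (suc N) + rest
      ≈⟨ +-congʳ (J-summation-by-parts N u w) ⟩
    ∑[ l < suc N ] (u l * J w l) + u (suc N) * w N + rest
      ≈⟨ solve 7 (λ S b c w₀ w₁ w₂ x → S :+ b :* w₀ :+ (x :* b :* w₁ :+ c :* w₁ :+ b :* w₂)
                                      := S :+ b :* (w₀ :+ x :* w₁ :+ w₂) :+ c :* w₁)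
               refl _ _ _ _ _ _ x ⟩
    ∑[ l < suc N ] (u l * J w l) + u (suc N) * J w (suc N) + u (suc (suc N)) * w (suc N)
      ≈⟨ +-congʳ (∑-last (suc N) _) ⟨
    ∑[ l < suc (suc N) ] (u l * J w l) + u (suc (suc N)) * w (suc N)
      ∎
    where
    rest = x * u (suc N) * w (suc N) + u (suc (suc N)) * w (suc N) + u (suc N) * w (suc (suc N))

  J-selfAdjoint : ∀ N u w → u N ≈ 0# → u (suc N) ≈ 0# →
    ∑[ l < suc N ] (J u l * w l) ≈ ∑[ l < suc N ] (u l * J w l)
  J-selfAdjoint N u w uN≈0 u1+N≈0 = begin
    ∑[ l < suc N ] (J u l * w l)                   ≈⟨ +-identityʳ _ ⟨
    ∑[ l < suc N ] (J u l * w l) + 0#              ≈⟨ +-congˡ (trans (*-congʳ uN≈0) (zeroˡ _)) ⟨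
    ∑[ l < suc N ] (J u l * w l) + u N * w (suc N) ≈⟨ J-summation-by-parts N u w ⟩
    ∑[ l < suc N ] (u l * J w l) + u (suc N) * w N ≈⟨ +-congˡ (trans (*-congʳ u1+N≈0) (zeroˡ _)) ⟩
    ∑[ l < suc N ] (u l * J w l) + 0#              ≈⟨ +-identityʳ _ ⟩
    ∑[ l < suc N ] (u l * J w l)                   ∎

  J-∑ : ∀ n (g : ℕ → ℕ → Carrier) l → J (λ l′ → ∑[ m < n ] g l′ m) l ≈ ∑[ m < n ] J (λ l′ → g l′ m) l
  J-∑ n g zero    = begin
    x * ∑[ m < n ] g 0 m + ∑[ m < n ] g 1 m      ≈⟨ +-congʳ (*-distribˡ-∑ n x _) ⟩
    ∑[ m < n ] (x * g 0 m) + ∑[ m < n ] g 1 m    ≈⟨ ∑-distrib-+ n _ _ ⟨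
    ∑[ m < n ] (x * g 0 m + g 1 m)              ∎
  J-∑ n g (suc l) = begin
    ∑[ m < n ] g l m + x * ∑[ m < n ] g (suc l) m + ∑[ m < n ] g (suc (suc l)) m
      ≈⟨ +-congʳ (+-congˡ (*-distribˡ-∑ n x _)) ⟩
    ∑[ m < n ] g l m + ∑[ m < n ] (x * g (suc l) m) + ∑[ m < n ] g (suc (suc l)) m
      ≈⟨ +-congʳ (∑-distrib-+ n _ _) ⟨
    ∑[ m < n ] (g l m + x * g (suc l) m) + ∑[ m < n ] g (suc (suc l)) m
      ≈⟨ ∑-distrib-+ n _ _ ⟨
    ∑[ m < n ] (g l m + x * g (suc l) m + g (suc (suc l)) m)
      ∎

  J-*ʳ : ∀ u y l → J (λ l′ → u l′ * y) l ≈ J u l * y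
  J-*ʳ u y zero    = solve 4 (λ x u₀ u₁ y → x :* (u₀ :* y) :+ u₁ :* y := (x :* u₀ :+ u₁) :* y) refl x _ _ y
  J-*ʳ u y (suc l) =
    solve 5 (λ x u₀ u₁ u₂ y → u₀ :* y :+ x :* (u₁ :* y) :+ u₂ :* y := (u₀ :+ x :* u₁ :+ u₂) :* y) refl x _ _ _ y

  Tv : ℕ → (ℕ → Carrier) → ℕ → Carrier
  Tv N v l = ∑[ m < N ] (T l m * v m)

  T-form : ℕ → (ℕ → Carrier) → (ℕ → Carrier) → Carrier
  T-form N u v = ∑[ l < N ] (u l * Tv N v l)

  T-form-cong : ∀ N {u u′ v v′} → (∀ l → u l ≈ u′ l) → (∀ m → v m ≈ v′ m) → T-form N u v ≈ T-form N u′ v′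
  T-form-cong N u≈u′ v≈v′ = ∑-cong N λ l _ → *-cong (u≈u′ l) (∑-cong N λ m _ → *-congˡ (v≈v′ m))

  J-Tv : ∀ N v l → v N ≈ 0# → v (suc N) ≈ 0# → J (Tv (suc N) v) l ≈ Tv (suc N) (J v) l
  J-Tv N v l vN≈0 v1+N≈0 = begin
    J (λ l′ → ∑[ m < suc N ] (T l′ m * v m)) l        ≈⟨ J-∑ (suc N) _ l ⟩
    ∑[ m < suc N ] J (λ l′ → T l′ m * v m) l          ≈⟨ ∑-cong (suc N) (λ m _ → trans (J-*ʳ (λ l′ → T l′ m) (v m) l)
                                                                            (trans (*-congʳ (J-T-commute l m)) (*-comm _ _))) ⟩
    ∑[ m < suc N ] (v m * J (T l) m)                  ≈⟨ J-selfAdjoint N v (T l) vN≈0 v1+N≈0 ⟨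
    ∑[ m < suc N ] (J v m * T l m)                    ≈⟨ ∑-cong (suc N) (λ m _ → *-comm _ _) ⟩
    ∑[ m < suc N ] (T l m * J v m)                    ∎

  T-form-J : ∀ N u v → u N ≈ 0# → u (suc N) ≈ 0# → v N ≈ 0# → v (suc N) ≈ 0# →
    T-form (suc N) (J u) v ≈ T-form (suc N) u (J v)
  T-form-J N u v uN≈0 u1+N≈0 vN≈0 v1+N≈0 = begin
    ∑[ l < suc N ] (J u l * Tv (suc N) v l)     ≈⟨ J-selfAdjoint N u (Tv (suc N) v) uN≈0 u1+N≈0 ⟩
    ∑[ l < suc N ] (u l * J (Tv (suc N) v) l)   ≈⟨ ∑-cong (suc N) (λ l _ → *-congˡ (J-Tv N v l vN≈0 v1+N≈0)) ⟩
    ∑[ l < suc N ] (u l * Tv (suc N) (J v) l)   ∎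

  -- Induction on i moves one factor J from the second argument to the first; the base case uses that
  -- row 0 of T is e_k.
  A-T-form : ∀ i j N → k < N → suc (suc (i ℕ.+ j)) ≤ N → A (i ℕ.+ j) k ≈ T-form N (A i) (A j)
  A-T-form zero j N k<N _ = sym (begin
    ∑[ l < N ] (A 0 l * Tv N (A j) l)
      ≈⟨ ∑-δ N 0 (ℕₚ.≤-<-trans z≤n k<N) (λ { (suc l) _ _ → zeroˡ _ ; zero _ 0≢0 → ⊥-elim (0≢0 ≡.refl) }) ⟩
    1# * Tv N (A j) 0                    ≈⟨ *-identityˡ _ ⟩
    ∑[ m < N ] (T 0 m * A j m)
      ≈⟨ ∑-δ N k k<N (λ m _ m≢k → trans (*-congʳ (trans (T-zeroˡ m) (𝟙-no (m ≟ k) m≢k))) (zeroˡ _)) ⟩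
    T 0 k * A j k                        ≈⟨ trans (*-congʳ (trans (T-zeroˡ k) (𝟙-yes (k ≟ k) ≡.refl))) (*-identityˡ _) ⟩
    A j k                                ∎)
  A-T-form (suc i) j (suc N) k<N 3+i+j≤1+N = begin
    A (suc i ℕ.+ j) k                       ≡⟨ ≡.cong (λ n → A n k) (ℕₚ.+-suc i j) ⟨
    A (i ℕ.+ suc j) k
      ≈⟨ A-T-form i (suc j) (suc N) k<N (≡.subst (λ n → suc (suc n) ≤ suc N) (≡.sym (ℕₚ.+-suc i j)) 3+i+j≤1+N) ⟩
    T-form (suc N) (A i) (A (suc j))        ≈⟨ T-form-cong (suc N) (λ _ → refl) (reflexive ∘ A-suc j) ⟩
    T-form (suc N) (A i) (J (A j))          ≈⟨ T-form-J N (A i) (A j) (A-upper i<N) (A-upper (ℕₚ.m<n⇒m<1+n i<N))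
                                                                     (A-upper j<N) (A-upper (ℕₚ.m<n⇒m<1+n j<N)) ⟨
    T-form (suc N) (J (A i)) (A j)          ≈⟨ T-form-cong (suc N) (reflexive ∘ ≡.sym ∘ A-suc i) (λ _ → refl) ⟩
    T-form (suc N) (A (suc i)) (A j)        ∎
    where
    2+i+j≤N : suc (suc (i ℕ.+ j)) ≤ N
    2+i+j≤N = ℕₚ.≤-pred 3+i+j≤1+N
    i<N : i < N
    i<N = ℕₚ.≤-trans (s≤s (ℕₚ.≤-trans (ℕₚ.m≤m+n i j) (ℕₚ.n≤1+n (i ℕ.+ j)))) 2+i+j≤N
    j<N : j < N
    j<N = ℕₚ.≤-trans (s≤s (ℕₚ.≤-trans (ℕₚ.m≤n+m j i) (ℕₚ.n≤1+n (i ℕ.+ j)))) 2+i+j≤N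

  T-form-truncate : ∀ N d {u v} → (∀ l → N ≤ l → u l ≈ 0#) → (∀ m → N ≤ m → v m ≈ 0#) →
    T-form (N ℕ.+ d) u v ≈ T-form N u v
  T-form-truncate N d {u} {v} u≈0 v≈0 = begin
    ∑[ l < N ℕ.+ d ] (u l * Tv (N ℕ.+ d) v l)
      ≈⟨ ∑-+ N d _ ⟩
    ∑[ l < N ] (u l * Tv (N ℕ.+ d) v l) + ∑[ l < d ] (u (N ℕ.+ l) * Tv (N ℕ.+ d) v (N ℕ.+ l))
      ≈⟨ +-cong (∑-cong N λ l _ → *-congˡ (Tv-truncate l))
                (∑-zero d λ l _ → trans (*-congʳ (u≈0 (N ℕ.+ l) (ℕₚ.m≤m+n N l))) (zeroˡ _)) ⟩
    T-form N u v + 0#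
      ≈⟨ +-identityʳ _ ⟩
    T-form N u v
      ∎
    where
    Tv-truncate : ∀ l → Tv (N ℕ.+ d) v l ≈ Tv N v l
    Tv-truncate l =
      trans (∑-+ N d _) (trans (+-congˡ (∑-zero d λ m _ → trans (*-congˡ (v≈0 (N ℕ.+ m) (ℕₚ.m≤m+n N m))) (zeroʳ _)))
                                             (+-identityʳ _))

  hankel-factorisation : ∀ N i j → i < N → j < N → A (i ℕ.+ j) k ≈ mul N A (mul N T (transpose A)) i j
  hankel-factorisation N i j i<N j<N = begin
    A (i ℕ.+ j) k                 ≈⟨ A-T-form i j (N ℕ.+ d) (ℕₚ.<-≤-trans k<d (ℕₚ.m≤n+m d N))
                                                            (ℕₚ.≤-trans 2+i+j≤d (ℕₚ.m≤n+m d N)) ⟩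
    T-form (N ℕ.+ d) (A i) (A j)  ≈⟨ T-form-truncate N d (λ l N≤l → A-upper (ℕₚ.<-≤-trans i<N N≤l))
                                                          (λ m N≤m → A-upper (ℕₚ.<-≤-trans j<N N≤m)) ⟩
    T-form N (A i) (A j)          ∎
    where
    d = suc (suc (i ℕ.+ j ℕ.+ k))
    k<d : k < d
    k<d = s≤s (ℕₚ.≤-trans (ℕₚ.m≤n+m k (i ℕ.+ j)) (ℕₚ.n≤1+n _))
    2+i+j≤d : suc (suc (i ℕ.+ j)) ≤ d
    2+i+j≤d = s≤s (s≤s (ℕₚ.m≤m+n (i ℕ.+ j) k))

  det-hankel : ∀ N → det N (λ i j → A (i ℕ.+ j) k) ≈ det N T
  det-hankel N = begin
    det N (λ i j → A (i ℕ.+ j) k)             ≈⟨ det-cong N (hankel-factorisation N) ⟩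
    det N (mul N A (mul N T (transpose A)))   ≈⟨ det-mul-lowerUnitriangular N _ A-lowerUnitriangular ⟩
    det N (mul N T (transpose A))             ≈⟨ det-mul-upperUnitriangular N T A-lowerUnitriangular ⟩
    det N T                                   ∎

  K : ℕ
  K = suc k

  Reflected : ℕ → ℕ → Set
  Reflected m j = k < j × m ℕ.+ j ≡ k ℕ.+ k

  reflected? : ∀ m j → Dec (Reflected m j)
  reflected? m j = k <? j ×-dec m ℕ.+ j ≟ k ℕ.+ k

  -- Right multiplication by E subtracts column 2k − j from every column j with k < j ≤ 2k.
  E : Matrix
  E m j = 𝟙 (m ≟ j) - 𝟙 (reflected? m j)

  ¬Reflected-≥ : ∀ {m j} → j ≤ m → ¬ Reflected m j
  ¬Reflected-≥ {m} {j} j≤m (k<j , m+j≡k+k) =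
    ℕₚ.<-irrefl (≡.sym m+j≡k+k) (ℕₚ.<-≤-trans (ℕₚ.+-mono-< k<j k<j) (ℕₚ.+-monoˡ-≤ j j≤m))

  E-upperUnitriangular : UpperUnitriangular E
  E-upperUnitriangular = below , diagonal
    where
    below : ∀ m j → j < m → E m j ≈ 0#
    below m j j<m = begin
      𝟙 (m ≟ j) - 𝟙 (reflected? m j)
        ≈⟨ +-cong (𝟙-no (m ≟ j) (ℕₚ.>⇒≢ j<m)) (-‿cong (𝟙-no (reflected? m j) (¬Reflected-≥ (ℕₚ.<⇒≤ j<m)))) ⟩
      0# - 0#                         ≈⟨ -‿inverseʳ 0# ⟩
      0#                              ∎
    diagonal : ∀ j → E j j ≈ 1#
    diagonal j = begin
      𝟙 (j ≟ j) - 𝟙 (reflected? j j)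
        ≈⟨ +-cong (𝟙-yes (j ≟ j) ≡.refl) (-‿cong (𝟙-no (reflected? j j) (¬Reflected-≥ ℕₚ.≤-refl))) ⟩
      1# - 0#                         ≈⟨ +-congˡ -0#≈0# ⟩
      1# + 0#                         ≈⟨ +-identityʳ 1# ⟩
      1#                              ∎

  reflectedSum : ℕ → ℕ → ℕ → Carrier
  reflectedSum N l j = ∑[ m < N ] (T l m * 𝟙 (reflected? m j))

  TE-entry : ∀ N l j → j < N → mul N T E l j ≈ T l j - reflectedSum N l j
  TE-entry N l j j<N = begin
    ∑[ m < N ] (T l m * (𝟙 (m ≟ j) - 𝟙 (reflected? m j)))                   ≈⟨ ∑-cong N (λ m _ → x[y-z]≈xy-xz _ _ _) ⟩
    ∑[ m < N ] (T l m * 𝟙 (m ≟ j) - T l m * 𝟙 (reflected? m j))            ≈⟨ ∑-distrib-+ N _ _ ⟩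
    ∑[ m < N ] (T l m * 𝟙 (m ≟ j)) + ∑[ m < N ] (- (T l m * 𝟙 (reflected? m j)))
      ≈⟨ +-cong (∑-δ N j j<N λ m _ m≢j → trans (*-congˡ (𝟙-no (m ≟ j) m≢j)) (zeroʳ _)) (sym (-‿distrib-∑ N _)) ⟩
    T l j * 𝟙 (j ≟ j) - reflectedSum N l j
      ≈⟨ +-congʳ (trans (*-congˡ (𝟙-yes (j ≟ j) ≡.refl)) (*-identityʳ _)) ⟩
    T l j - reflectedSum N l j                                              ∎

  x-y≈x : ∀ {x y} → y ≈ 0# → x - y ≈ x
  x-y≈x y≈0 = trans (+-congˡ (trans (-‿cong y≈0) -0#≈0#)) (+-identityʳ _)

  [x+y]-y≈x : ∀ x y → x + y - y ≈ x
  [x+y]-y≈x x y = trans (+-assoc x y (- y)) (trans (+-congˡ (-‿inverseʳ y)) (+-identityʳ x))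

  reflectedSum-≤ : ∀ N l {j} → j ≤ k → reflectedSum N l j ≈ 0#
  reflectedSum-≤ N l {j} j≤k =
    ∑-zero N λ m _ → trans (*-congˡ (𝟙-no (reflected? m j) λ r → ℕₚ.<⇒≱ (proj₁ r) j≤k)) (zeroʳ _)

  reflectedSum-beyond : ∀ N l {j} → k ≤ j → reflectedSum N l (K ℕ.+ j) ≈ 0#
  reflectedSum-beyond N l {j} k≤j =
    ∑-zero N λ m _ → trans (*-congˡ (𝟙-no (reflected? m (K ℕ.+ j)) λ r → ℕₚ.<-irrefl (≡.sym (proj₂ r)) (k+k< m))) (zeroʳ _)
    where
    k+k< : ∀ m → k ℕ.+ k < m ℕ.+ (K ℕ.+ j)
    k+k< m = ℕₚ.<-≤-trans (s≤s (ℕₚ.+-monoʳ-≤ k k≤j)) (ℕₚ.m≤n+m (K ℕ.+ j) m)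

  mirror : ∀ {j p} → k ≡ suc (j ℕ.+ p) → p ℕ.+ (K ℕ.+ j) ≡ k ℕ.+ k
  mirror {j} {p} ≡.refl = eq j p
    where
    eq : ∀ j p → p ℕ.+ (suc (suc (j ℕ.+ p)) ℕ.+ j) ≡ suc (j ℕ.+ p) ℕ.+ suc (j ℕ.+ p)
    eq = solve-∀

  reflectedSum-mirror : ∀ N l {j p} → k ≡ suc (j ℕ.+ p) → p < N → reflectedSum N l (K ℕ.+ j) ≈ T l p
  reflectedSum-mirror N l {j} {p} k≡1+j+p p<N = begin
    reflectedSum N l (K ℕ.+ j)
      ≈⟨ ∑-δ N p p<N (λ m _ m≢p → trans (*-congˡ (𝟙-no (reflected? m (K ℕ.+ j)) (m≢p ∘ m≡p))) (zeroʳ _)) ⟩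
    T l p * 𝟙 (reflected? p (K ℕ.+ j))       ≈⟨ *-congˡ (𝟙-yes (reflected? p (K ℕ.+ j)) (k<K+j , mirror k≡1+j+p)) ⟩
    T l p * 1#                               ≈⟨ *-identityʳ _ ⟩
    T l p                                    ∎
    where
    k<K+j : k < K ℕ.+ j
    k<K+j = s≤s (ℕₚ.m≤m+n k j)
    m≡p : ∀ {m} → Reflected m (K ℕ.+ j) → m ≡ p
    m≡p (_ , m+K+j≡k+k) = ℕₚ.+-cancelʳ-≡ (K ℕ.+ j) _ _ (≡.trans m+K+j≡k+k (≡.sym (mirror k≡1+j+p)))

  mirror-index : ∀ {j} → j < k → ∃ λ p → k ≡ suc (j ℕ.+ p)
  mirror-index j<k = let p , 1+j+p≡k = ℕₚ.m≤n⇒∃[o]m+o≡n j<k in p , ≡.sym 1+j+p≡k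

  mirror-< : ∀ {j p} N′ → k ≡ suc (j ℕ.+ p) → p < K ℕ.+ N′
  mirror-< {j} {p} N′ k≡1+j+p =
    ℕₚ.<-≤-trans (s≤s (ℕₚ.≤-trans (ℕₚ.m≤n+m p j) (ℕₚ.≤-trans (ℕₚ.n≤1+n _) (ℕₚ.≤-reflexive (≡.sym k≡1+j+p)))))
                 (ℕₚ.m≤m+n K N′)

  module _ (N′ : ℕ) where

    TE : Matrix
    TE = mul (K ℕ.+ N′) T E

    TE-topLeft : ∀ i j → j < K → TE i j ≈ T i j
    TE-topLeft i j j<K =
      trans (TE-entry _ i j (ℕₚ.<-≤-trans j<K (ℕₚ.m≤m+n K N′))) (x-y≈x (reflectedSum-≤ _ i (ℕₚ.≤-pred j<K)))

    TE-topRight : ∀ i j → i < K → K ≤ j → j < K ℕ.+ N′ → TE i j ≈ 0#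
    TE-topRight i j (s≤s i≤k) K≤j j<K+N′ with ℕₚ.m≤n⇒∃[o]m+o≡n K≤j
    ... | j′ , ≡.refl with j′ <? k
    ...   | yes j′<k = begin
      TE i (K ℕ.+ j′)                        ≈⟨ TE-entry _ i _ j<K+N′ ⟩
      T i (K ℕ.+ j′) - reflectedSum _ i (K ℕ.+ j′) ≈⟨ +-congˡ (-‿cong (reflectedSum-mirror _ i k≡ (mirror-< N′ k≡))) ⟩
      T i (K ℕ.+ j′) - T i p                ≈⟨ +-congʳ (𝟙-cong reflect (triangle? k i (K ℕ.+ j′)) (triangle? k i p)) ⟩
      T i p - T i p                         ≈⟨ -‿inverseʳ _ ⟩
      0#                                    ∎
      where
      p  = proj₁ (mirror-index j′<k)
      k≡ = proj₂ (mirror-index j′<k)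
      reflect : Triangle k i (K ℕ.+ j′) ⇔ Triangle k i p
      reflect = mk⇔ (Triangle-reflect i≤k (≡.trans (ℕₚ.+-comm (K ℕ.+ j′) p) (mirror k≡)))
                    (Triangle-reflect i≤k (mirror k≡))
    ...   | no j′≮k = begin
      TE i (K ℕ.+ j′)                              ≈⟨ TE-entry _ i _ j<K+N′ ⟩
      T i (K ℕ.+ j′) - reflectedSum _ i (K ℕ.+ j′) ≈⟨ x-y≈x (reflectedSum-beyond _ i (ℕₚ.≮⇒≥ j′≮k)) ⟩
      T i (K ℕ.+ j′)                               ≈⟨ 𝟙-no (triangle? k i (K ℕ.+ j′)) (>⇒¬Triangle k+i<K+j′) ⟩
      0#                                           ∎
      where
      k+i<K+j′ : k ℕ.+ i < K ℕ.+ j′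
      k+i<K+j′ = s≤s (ℕₚ.+-monoʳ-≤ k (ℕₚ.≤-trans i≤k (ℕₚ.≮⇒≥ j′≮k)))

    TE-bottomRight : ∀ i j → j < N′ → TE (K ℕ.+ i) (K ℕ.+ j) ≈ T i j
    TE-bottomRight i j j<N′ with j <? k
    ... | yes j<k = begin
      TE (K ℕ.+ i) (K ℕ.+ j)                                        ≈⟨ TE-entry _ _ _ (ℕₚ.+-monoʳ-< K j<N′) ⟩
      T (K ℕ.+ i) (K ℕ.+ j) - reflectedSum _ (K ℕ.+ i) (K ℕ.+ j)
        ≈⟨ +-cong T-block (-‿cong (reflectedSum-mirror _ _ k≡ (mirror-< N′ k≡))) ⟩
      T i j + T (K ℕ.+ i) p - T (K ℕ.+ i) p                          ≈⟨ [x+y]-y≈x _ _ ⟩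
      T i j                                                         ∎
      where
      p  = proj₁ (mirror-index j<k)
      k≡ = proj₂ (mirror-index j<k)
      T-block : T (K ℕ.+ i) (K ℕ.+ j) ≈ T i j + T (K ℕ.+ i) p
      T-block = 𝟙-⊎ (Triangle-block k≡) (Triangle-block-disjoint k≡)
                    (triangle? k (K ℕ.+ i) (K ℕ.+ j)) (triangle? k i j) (triangle? k (K ℕ.+ i) p)
    ... | no j≮k = begin
      TE (K ℕ.+ i) (K ℕ.+ j)                                        ≈⟨ TE-entry _ _ _ (ℕₚ.+-monoʳ-< K j<N′) ⟩
      T (K ℕ.+ i) (K ℕ.+ j) - reflectedSum _ (K ℕ.+ i) (K ℕ.+ j)    ≈⟨ x-y≈x (reflectedSum-beyond _ _ (ℕₚ.≮⇒≥ j≮k)) ⟩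
      T (K ℕ.+ i) (K ℕ.+ j)
        ≈⟨ 𝟙-cong (Triangle-+ K k≤i+j) (triangle? k (K ℕ.+ i) (K ℕ.+ j)) (triangle? k i j) ⟩
      T i j                                                         ∎
      where
      k≤i+j : k ≤ i ℕ.+ j
      k≤i+j = ℕₚ.≤-trans (ℕₚ.≮⇒≥ j≮k) (ℕₚ.m≤n+m j i)

  det-T-step : ∀ N′ → det (K ℕ.+ N′) T ≈ -1^ (K C 2) * det N′ T
  det-T-step N′ = begin
    det (K ℕ.+ N′) T                                          ≈⟨ det-mul-upperUnitriangular (K ℕ.+ N′) T E-upperUnitriangular ⟨
    det (K ℕ.+ N′) (TE N′)                                    ≈⟨ det-blockUpper K N′ (TE N′) (TE-topRight N′) ⟩
    det K (TE N′) * det N′ (λ i j → TE N′ (K ℕ.+ i) (K ℕ.+ j)) ≈⟨ *-cong (det-cong K λ i j _ → TE-topLeft N′ i j)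
                                                                          (det-cong N′ λ i j _ → TE-bottomRight N′ i j) ⟩
    det K T * det N′ T                                        ≈⟨ *-congʳ (det-antitriangular k T T≈0 T≈1) ⟩
    -1^ (K C 2) * det N′ T                                    ∎
    where
    T≈0 : ∀ i j → i ℕ.+ j < k → T i j ≈ 0#
    T≈0 i j i+j<k = 𝟙-no (triangle? k i j) (<⇒¬Triangle i+j<k)
    T≈1 : ∀ i j → i ℕ.+ j ≡ k → T i j ≈ 1#
    T≈1 i j i+j≡k = 𝟙-yes (triangle? k i j) (≡⇒Triangle i+j≡k)

  det-T-small : ∀ n → n < k → det (suc n) T ≈ 0#
  det-T-small n n<k = det-zeroRow n T λ j j<1+n →
    trans (T-zeroˡ j) (𝟙-no (j ≟ k) λ j≡k → ℕₚ.<-irrefl j≡k (ℕₚ.<-≤-trans j<1+n n<k))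

  det-T-periodic : ∀ q N → det (K ℕ.* q ℕ.+ N) T ≈ -1^ ((K C 2) ℕ.* q) * det N T
  det-T-periodic zero    N = begin
    det (K ℕ.* 0 ℕ.+ N) T      ≡⟨ ≡.cong (λ n → det (n ℕ.+ N) T) (ℕₚ.*-zeroʳ K) ⟩
    det N T                   ≈⟨ *-identityˡ _ ⟨
    1# * det N T              ≡⟨ ≡.cong (λ n → -1^ n * det N T) (ℕₚ.*-zeroʳ (K C 2)) ⟨
    -1^ ((K C 2) ℕ.* 0) * det N T ∎
  det-T-periodic (suc q) N = begin
    det (K ℕ.* suc q ℕ.+ N) T                    ≡⟨ ≡.cong (λ n → det n T) regroup ⟩
    det (K ℕ.+ (K ℕ.* q ℕ.+ N)) T                ≈⟨ det-T-step _ ⟩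
    -1^ (K C 2) * det (K ℕ.* q ℕ.+ N) T          ≈⟨ *-congˡ (det-T-periodic q N) ⟩
    -1^ (K C 2) * (-1^ ((K C 2) ℕ.* q) * det N T)  ≈⟨ *-assoc _ _ _ ⟨
    -1^ (K C 2) * -1^ ((K C 2) ℕ.* q) * det N T    ≈⟨ *-congʳ (-1^-+ (K C 2) ((K C 2) ℕ.* q)) ⟨
    -1^ (K C 2 ℕ.+ (K C 2) ℕ.* q) * det N T        ≡⟨ ≡.cong (λ n → -1^ n * det N T) (ℕₚ.*-suc (K C 2) q) ⟨
    -1^ ((K C 2) ℕ.* suc q) * det N T              ∎
    where
    regroup : K ℕ.* suc q ℕ.+ N ≡ K ℕ.+ (K ℕ.* q ℕ.+ N)
    regroup = ≡.trans (≡.cong (ℕ._+ N) (ℕₚ.*-suc K q)) (ℕₚ.+-assoc K (K ℕ.* q) N)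

  D₀≈det-T : ∀ n → D0 R (λ _ → x) k n ≈ det n T
  D₀≈det-T n = trans (Defs-det≈det n (λ i j → A (i ℕ.+ j) k)) (det-hankel n)

  D₀-multiple : ∀ n → D0 R (λ _ → x) k (K ℕ.* n) ≈ -1^ ((K C 2) ℕ.* n)
  D₀-multiple n = begin
    D0 R (λ _ → x) k (K ℕ.* n)   ≈⟨ D₀≈det-T (K ℕ.* n) ⟩
    det (K ℕ.* n) T              ≡⟨ ≡.cong (λ m → det m T) (ℕₚ.+-identityʳ (K ℕ.* n)) ⟨
    det (K ℕ.* n ℕ.+ 0) T        ≈⟨ det-T-periodic n 0 ⟩
    -1^ ((K C 2) ℕ.* n) * 1#     ≈⟨ *-identityʳ _ ⟩
    -1^ ((K C 2) ℕ.* n)          ∎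

  D₀-nonmultiple : ∀ n → ¬ K ∣ n → D0 R (λ _ → x) k n ≈ 0#
  D₀-nonmultiple n K∤n = begin
    D0 R (λ _ → x) k n                         ≈⟨ D₀≈det-T n ⟩
    det n T                                    ≡⟨ ≡.cong (λ m → det m T) division ⟩
    det (K ℕ.* (n / K) ℕ.+ n % K) T            ≈⟨ det-T-periodic (n / K) (n % K) ⟩
    -1^ ((K C 2) ℕ.* (n / K)) * det (n % K) T
      ≈⟨ *-congˡ (remainder-vanishes (n % K) (m%n<n n K) (K∤n ∘ m%n≡0⇒n∣m n K)) ⟩
    -1^ ((K C 2) ℕ.* (n / K)) * 0#             ≈⟨ zeroʳ _ ⟩
    0#                                         ∎
    where
    division : n ≡ K ℕ.* (n / K) ℕ.+ n % K
    division = ≡.trans (m≡m%n+[m/n]*n n K)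
                       (≡.trans (ℕₚ.+-comm (n % K) _) (≡.cong (ℕ._+ n % K) (ℕₚ.*-comm (n / K) K)))
    remainder-vanishes : ∀ r → r < K → r ≢ 0 → det r T ≈ 0#
    remainder-vanishes zero    _         r≢0 = ⊥-elim (r≢0 ≡.refl)
    remainder-vanishes (suc r) (s≤s r<k) _   = det-T-small r r<k

-- Imported only now: inside the modules above, _*_ is the ring multiplication.
open import Data.Nat using (_*_)

mainTheorem3 : {c ℓ : Level} (R : CommutativeRing c ℓ) (x : CommutativeRing.Carrier R) (k : ℕ) →
    ((n : ℕ) → CommutativeRing._≈_ R (D0 R (λ _ → x) k (suc k * n)) (sgn R ((suc k C 2) * n)))
    × ((n : ℕ) → ¬ (suc k ∣ n) → CommutativeRing._≈_ R (D0 R (λ _ → x) k n) (CommutativeRing.0# R))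
mainTheorem3 R x k = D₀-multiple , D₀-nonmultiple
  where open Hankel R x k
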